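{- Let $\Gamma$ be any 4-ary construction in which every vertex is assigned an eight-vertex constraint function whose parameter tuple $(a,b,c,d)$ lies in $\overline{\mathcal{F}_>}$. Then the constraint function $f$ defined by $\Gamma$ is again an eight-vertex constraint function, and its parameter tuple $(a',b',c',d')$ also lies in $\overline{\mathcal{F}_>}$. That is, the set of eight-vertex constraint functions with parameters in $\overline{\mathcal{F}_>}$ is closed under 4-ary constructions.
   Context: An eight-vertex constraint function with parameters $(a,b,c,d)\in\mathbb{R}_{\ge 0}^4$ is the function $f:\{0,1\}^4\to\mathbb{R}_{\ge0}$ given by $f(0011)=f(1100)=a$, $f(0110)=f(1001)=b$, $f(0101)=f(1010)=c$, $f(0000)=f(1111)=d$, and $f(x)=0$ whenever $x$ has an odd number of ones. It is placed at a vertex whose four incident edge-ends are labeled $e_1,e_2,e_3,e_4$; given an orientation of the edges, the $i$-th input bit is $0$ if $e_i$ points into the vertex and $1$ if it points out. Define $\overline{\mathcal{F}_>}$ as the set of $(a,b,c,d)\in\mathbb{R}_{\ge0}^4$ satisfying $a\le b+c+d$, $b\le a+c+d$, $c\le a+b+d$ and $d\le a+b+c$ (i.e. no parameter exceeds the sum of the other three). A 4-ary construction is a finite graph $\Gamma$ (multiple edges and loops allowed) together with four dangling edges $e_1,e_2,e_3,e_4$, each attached at one end to a vertex of $\Gamma$, such that every vertex has degree exactly $4$ (counting dangling edges and counting loops twice); at each vertex the four incident edge-ends are labeled $1,2,3,4$ and a constraint function is assigned. The constraint function $f$ defined by $\Gamma$ is the function on $\{0,1\}^4$ with $f(b_1b_2b_3b_4)=\sum_\sigma\prod_{v}f_v(\sigma|_v)$,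 the sum over all orientations $\sigma$ of the internal edges of $\Gamma$, where each dangling edge $e_i$ is oriented into $\Gamma$ if $b_i=0$ and out of $\Gamma$ if $b_i=1$, and $f_v(\sigma|_v)$ is the constraint function at $v$ evaluated on the induced local orientation. -}

module Defs where

open import Level using (0ℓ)
open import Data.Nat using (ℕ; zero; suc)
open import Data.Fin using (Fin; zero; suc)
open import Data.Bool using (Bool; true; false; not; _xor_; _∧_; if_then_else_)
open import Data.List using (List; allFin)
open import Data.Bool.ListAction using (all)
open import Data.Product using (Σ; ∃; ∃-syntax; _×_; _,_)
open import Data.Sum using (_⊎_; inj₁; inj₂)
open import Data.Vec.Functional using (Vector; _∷_)
open import Relation.Nullary using (¬_)
open import Relation.Binary.PropositionalEquality using (_≡_)
open import Relation.Binary.Core using (Rel)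
open import Relation.Binary.Structures using (IsTotalOrder)
open import Algebra.Structures using (IsCommutativeRing)

-- The real numbers, given axiomatically: a complete ordered field.
-- (agda-stdlib has no reals; we quantify over every model of the
-- axioms of a complete ordered field, all of which are isomorphic to ℝ.)

record RealModel : Set₁ where
  infixl 6 _+_
  infixl 7 _*_
  infix 4 _≤_
  field
    Carrier : Set
    _+_ _*_ : Carrier → Carrier → Carrier
    -_      : Carrier → Carrier
    0# 1#   : Carrier
    _≤_     : Rel Carrier 0ℓ
    isCommutativeRing : IsCommutativeRing _≡_ _+_ _*_ -_ 0# 1#
    isTotalOrder      : IsTotalOrder _≡_ _≤_
    0≢1      : ¬ (0# ≡ 1#)
    inverse  : ∀ x → ¬ (x ≡ 0#) → ∃[ y ] (x * y ≡ 1#)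
    +-monoˡ  : ∀ {x y} z → x ≤ y → x + z ≤ y + z
    *-nonneg : ∀ {x y} → 0# ≤ x → 0# ≤ y → 0# ≤ x * y
    complete : (P : Carrier → Set) → ∃ P → (∃[ u ] (∀ x → P x → x ≤ u)) →
               ∃[ s ] ((∀ x → P x → x ≤ s) × (∀ u → (∀ x → P x → x ≤ u) → s ≤ u))

-- Half-edges (edge-ends at vertices): (v , k), vertex v, label k ∈ {1,2,3,4}
-- (represented by Fin 4).  External ends: the outer ends of the four
-- dangling edges e₁..e₄.  Edges are encoded by a fixed-point-free
-- involution `match` on all ends: an internal edge pairs two half-edges
-- (possibly at the same vertex: loop), a dangling edge e_i pairs the
-- external end i with a half-edge at a vertex.

HalfEdge : ℕ → Set
HalfEdge n = Fin n × Fin 4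

End : ℕ → Set
End n = HalfEdge n ⊎ Fin 4

record Construction (n : ℕ) : Set where
  field
    match      : End n → End n
    involutive : ∀ e → match (match e) ≡ e
    noFix      : ∀ e → ¬ (match e ≡ e)
    dangling   : ∀ i → ∃[ h ] (match (inj₂ i) ≡ inj₁ h)

module _ (ℝ : RealModel) where
  open RealModel ℝ

  Params : Set
  Params = Carrier × Carrier × Carrier × Carrier

  -- eight-vertex function with parameters (a,b,c,d); input bit false = 0
  evalEV : Params → Bool → Bool → Bool → Bool → Carrier
  evalEV (a , b , c , d) false false true  true  = a
  evalEV (a , b , c , d) true  true  false false = a
  evalEV (a , b , c , d) false true  true  false = b
  evalEV (a , b , c , d) true  false false true  = b
  evalEV (a , b , c , d) false true  false true  = c
  evalEV (a , b , c , d) true  false true  false = c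
  evalEV (a , b , c , d) false false false false = d
  evalEV (a , b , c , d) true  true  true  true  = d
  evalEV _ _ _ _ _ = 0#

  eightVertex : Params → (Fin 4 → Bool) → Carrier
  eightVertex q x = evalEV q (x zero) (x (suc zero)) (x (suc (suc zero))) (x (suc (suc (suc zero))))

  InFbar : Params → Set
  InFbar (a , b , c , d) =
    (0# ≤ a) × (0# ≤ b) × (0# ≤ c) × (0# ≤ d) ×
    (a ≤ b + c + d) × (b ≤ a + c + d) × (c ≤ a + b + d) × (d ≤ a + b + c)

  sumBits : (k : ℕ) → ((Fin k → Bool) → Carrier) → Carrier
  sumBits zero    F = F (λ ())
  sumBits (suc k) F = sumBits k (λ g → F (false ∷ g)) + sumBits k (λ g → F (true ∷ g))

  sumAssign : (n : ℕ) → ((Fin n → Fin 4 → Bool) → Carrier) → Carrier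
  sumAssign zero    F = F (λ ())
  sumAssign (suc n) F = sumBits 4 (λ x → sumAssign n (λ g → F (x ∷ g)))

  prodV : (n : ℕ) → (Fin n → Carrier) → Carrier
  prodV zero    F = 1#
  prodV (suc n) F = F zero * prodV n (λ v → F (suc v))

  -- σ (v) (k) is the input bit at half-edge (v,k): false (0) if the edge
  -- points into v, true (1) if out of v.  σ comes from an orientation of
  -- the internal edges with dangling edges oriented by β iff:
  --  * the two ends of an internal edge carry opposite bits;
  --  * the half-edge attached to dangling edge e_i carries β i
  --    (e_i into Γ iff β i = 0).
  -- Such σ are in bijection with the orientations of the internal edges.
  module _ {n : ℕ} (Γ : Construction n) where
    open Construction Γ

    okAt : (Fin n → Fin 4 → Bool) → (Fin 4 → Bool) → HalfEdge n → Bool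
    okAt σ β (v , k) with match (inj₁ (v , k))
    ... | inj₁ (v' , k') = σ v k xor σ v' k'
    ... | inj₂ i         = not (σ v k xor β i)

    consistent : (Fin n → Fin 4 → Bool) → (Fin 4 → Bool) → Bool
    consistent σ β = all (λ v → all (λ k → okAt σ β (v , k)) (allFin 4)) (allFin n)

    constructionFn : (Fin n → Params) → (Fin 4 → Bool) → Carrier
    constructionFn p β =
      sumAssign n (λ σ → if consistent σ β
                           then prodV n (λ v → eightVertex (p v) (σ v))
                           else 0#)

module Submission where

-- The six pairing functions -- for a perfect matching {i,j},{k,l} of the four edge ends
-- and a bit c, the function that is 1 exactly when x_i ⊕ x_j = x_k ⊕ x_l = c -- are
-- eight-vertex functions with two parameters equal to 1 and two equal to 0, and F̄ is the
-- cone they span: (a,b,c,d) ∈ F̄ iff it is the weighted degree sequence of nonnegative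
-- weights on the edges of K₄. A construction is multilinear in its vertex functions, so it
-- suffices to evaluate constructions whose vertices carry pairing functions. Such a
-- construction counts the solutions of a system of XOR equations between edge ends in which
-- every internal end occurs twice and every dangling edge once. Eliminating the variables
-- one at a time -- the two equations through a variable are replaced by their sum, which
-- halves the count, and an equation between a variable and itself is either dropped or
-- makes the count vanish -- leaves two equations with equal labels pairing up the dangling
-- edges. So the construction is a nonnegative multiple of a pairing function, and by
-- multilinearity a nonnegative combination of pairing functions, which lies in F̄.

open import Defs
import Data.Nat.Properties as ℕ
open import Algebra.Bundles using (CommutativeRing; CommutativeMonoid)
import Algebra.Properties.Ring as RingProperties
import Algebra.Properties.Semiring.Sum as SemiringSum
open import Algebra.Properties.CommutativeMonoid.Sum ℕ.+-0-commutativeMonoid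
  using (sum-replicate-zero; sum-cong-≗; ∑-distrib-+)
open import Algebra.Properties.Monoid.Sum (CommutativeMonoid.monoid ℕ.+-0-commutativeMonoid) using (sum-syntax)
open import Algebra.Structures using (IsCommutativeMonoid; IsCommutativeRing)
open import Data.Bool using (Bool; true; false; not; _∧_; _∨_; _xor_; if_then_else_; T)
import Data.Bool.Properties as 𝔹
open import Data.Bool.ListAction using (all)
open import Data.Empty using (⊥-elim)
open import Data.Fin using (Fin; zero; suc; combine; remQuot)
open import Data.Fin.Patterns using (0F; 1F; 2F; 3F; 4F; 5F)
import Data.Fin.Properties as Fin
open import Data.List using (List; []; _∷_; _++_; map; foldr; concat; tabulate; length; allFin)
open import Data.List.Properties using (map-++)
open import Data.List.Relation.Binary.Permutation.Propositional using (_↭_; ↭⇒↭ₛ; swap; ↭-refl)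
open import Data.List.Relation.Binary.Permutation.Propositional.Properties using (map⁺)
open import Data.List.Relation.Binary.Permutation.Setoid.Properties using (foldr-commMonoid)
open import Data.List.Relation.Unary.All using (All; []; _∷_)
open import Data.List.Relation.Unary.All.Properties using (all⁺; all⁻; ++⁺; ++⁻; concat⁺; concat⁻; tabulate⁺; tabulate⁻)
open import Data.Maybe using (nothing)
open import Data.Nat using (ℕ; zero; suc) renaming (_+_ to _+ℕ_; _*_ to _*ℕ_; _≤_ to _≤ℕ_)
open import Data.Nat.ListAction using (sum)
open import Data.Nat.ListAction.Properties using (sum-++)
open import Data.Nat.Tactic.RingSolver using (solve-∀)
open import Data.Product using (Σ; ∃; ∃₂; ∃-syntax; _×_; _,_; proj₁; proj₂; uncurry)
open import Data.Product.Properties using (,-injective)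
open import Data.Sum using (_⊎_; inj₁; inj₂)
import Data.Sum.Properties as Sum
open import Data.Unit using (tt)
open import Data.Vec.Functional using (updateAt) renaming (_∷_ to _∷ᵛ_; [] to []ᵛ)
open import Data.Vec.Functional.Properties using (updateAt-updates; updateAt-minimal)
open import Function using (_∘_)
open import Function.Bundles using (mk⇔)
open import Relation.Binary.Definitions using (DecidableEquality; tri<; tri≈; tri>)
open import Relation.Binary.PropositionalEquality hiding ([_])
open import Relation.Binary.Structures using (IsTotalOrder)
open import Relation.Nullary using (¬_; Dec; does; yes; no; _×-dec_)
open import Relation.Nullary.Decidable using (map′; dec-true; dec-false; does-⇔; from-yes; _→-dec_)
open import Tactic.RingSolver.Core.AlmostCommutativeRing using (AlmostCommutativeRing; fromCommutativeRing)

private variable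
  A B : Set
  n : ℕ

-- Systems of XOR equations

Eqn : Set → Set
Eqn A = A × A × Bool

label : Eqn A → Bool
label (_ , _ , c) = c

holds : (A → Bool) → Eqn A → Bool
holds ν (t , s , c) = not (ν t xor ν s xor c)

solves : (A → Bool) → List (Eqn A) → Bool
solves ν = all (holds ν)

parityOf : (A → Bool) → List A → Bool
parityOf f xs = foldr _xor_ false (map f xs)

labelParity : List (Eqn A) → Bool
labelParity = parityOf (not ∘ label)

mapEqn : (A → B) → Eqn A → Eqn B
mapEqn f (t , s , c) = (f t , f s , c)

solves-map : (f : A → B) (ν : B → Bool) (E : List (Eqn A)) →
             solves ν (map (mapEqn f) E) ≡ solves (ν ∘ f) E
solves-map f ν []      = refl
solves-map f ν (e ∷ E) = cong (holds (ν ∘ f) e ∧_) (solves-map f ν E)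

solves-++ : ∀ (ν : A → Bool) E F → solves ν (E ++ F) ≡ solves ν E ∧ solves ν F
solves-++ ν []      F = refl
solves-++ ν (e ∷ E) F = trans (cong (holds ν e ∧_) (solves-++ ν E F)) (sym (𝔹.∧-assoc (holds ν e) _ _))

solves-cong : ∀ {ν ν′ : A → Bool} → (∀ a → ν a ≡ ν′ a) → ∀ E → solves ν E ≡ solves ν′ E
solves-cong ν≗ν′ []              = refl
solves-cong ν≗ν′ ((t , s , c) ∷ E) =
  cong₂ _∧_ (cong₂ (λ a b → not (a xor b xor c)) (ν≗ν′ t) (ν≗ν′ s)) (solves-cong ν≗ν′ E)

holds-swap : ∀ (ν : A → Bool) t s c → holds ν (s , t , c) ≡ holds ν (t , s , c)
holds-swap ν t s c = cong not (trans (sym (𝔹.xor-assoc (ν s) (ν t) c))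
                                     (trans (cong (_xor c) (𝔹.xor-comm (ν s) (ν t))) (𝔹.xor-assoc (ν t) (ν s) c)))

labelParity-map : (f : A → B) (E : List (Eqn A)) → labelParity (map (mapEqn f) E) ≡ labelParity E
labelParity-map f []      = refl
labelParity-map f (e ∷ E) = cong (not (label e) xor_) (labelParity-map f E)

[_] : Bool → ℕ
[ b ] = if b then 1 else 0

foldr-map-↭ : {_∙_ : B → B → B} {ε : B} → IsCommutativeMonoid _≡_ _∙_ ε →
              (f : A → B) {xs ys : List A} → xs ↭ ys →
              foldr _∙_ ε (map f xs) ≡ foldr _∙_ ε (map f ys)
foldr-map-↭ {B = B} isCM f p = foldr-commMonoid (setoid B) isCM (↭⇒↭ₛ (map⁺ f p))

module Occurrences {A : Set} (_≟_ : DecidableEquality A) where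

  δ : A → A → ℕ
  δ a b = [ does (a ≟ b) ]

  occ : A → Eqn A → ℕ
  occ y (t , s , _) = δ t y +ℕ δ s y

  occurrences : A → List (Eqn A) → ℕ
  occurrences y E = sum (map (occ y) E)

  δ-refl : ∀ a → δ a a ≡ 1
  δ-refl a rewrite dec-true (a ≟ a) refl = refl

  δ≡0⇒≢ : ∀ {a b} → δ a b ≡ 0 → a ≢ b
  δ≡0⇒≢ {a} δ≡0 refl with () ← trans (sym (δ-refl a)) δ≡0

  δ-involution : (f : A → A) → (∀ a → f (f a) ≡ a) → ∀ a b → δ (f a) b ≡ δ a (f b)
  δ-involution f inv a b = cong [_] (does-⇔ (mk⇔ (λ e → trans (sym (inv a)) (cong f e))
                                                 (λ e → trans (cong f e) (inv b)))
                                            (f a ≟ b) (a ≟ f b))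

  occ-loop : ∀ y c → occ y (y , y , c) ≡ 2
  occ-loop y c rewrite δ-refl y = refl

  record _≋_ (E F : List (Eqn A)) : Set where
    field
      same-solutions   : ∀ ν → solves ν E ≡ solves ν F
      same-occurrences : ∀ y → occurrences y E ≡ occurrences y F
      same-parity      : labelParity E ≡ labelParity F

  open _≋_ public

  ↭⇒≋ : ∀ {E F} → E ↭ F → E ≋ F
  ↭⇒≋ p = record
    { same-solutions   = λ ν → foldr-map-↭ (CommutativeMonoid.isCommutativeMonoid 𝔹.∧-commutativeMonoid) (holds ν) p
    ; same-occurrences = λ y → foldr-map-↭ ℕ.+-0-isCommutativeMonoid (occ y) p
    ; same-parity      = foldr-map-↭ (CommutativeRing.+-isCommutativeMonoid 𝔹.xor-∧-commutativeRing) (not ∘ label) p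
    }

  ≋-refl : ∀ {E} → E ≋ E
  ≋-refl = record { same-solutions = λ _ → refl ; same-occurrences = λ _ → refl ; same-parity = refl }

  ≋-trans : ∀ {E F G} → E ≋ F → F ≋ G → E ≋ G
  ≋-trans p q = record
    { same-solutions   = λ ν → trans (same-solutions p ν) (same-solutions q ν)
    ; same-occurrences = λ y → trans (same-occurrences p y) (same-occurrences q y)
    ; same-parity      = trans (same-parity p) (same-parity q)
    }

  ≋-∷ : ∀ e {E F} → E ≋ F → (e ∷ E) ≋ (e ∷ F)
  ≋-∷ e p = record
    { same-solutions   = λ ν → cong (holds ν e ∧_) (same-solutions p ν)
    ; same-occurrences = λ y → cong (occ y e +ℕ_) (same-occurrences p y)
    ; same-parity      = cong (not (label e) xor_) (same-parity p)
    }

  swapEnds-≋ : ∀ t s c E → ((s , t , c) ∷ E) ≋ ((t , s , c) ∷ E)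
  swapEnds-≋ t s c E = record
    { same-solutions   = λ ν → cong (_∧ solves ν E) (holds-swap ν t s c)
    ; same-occurrences = λ y → cong (_+ℕ occurrences y E) (ℕ.+-comm (δ s y) (δ t y))
    ; same-parity      = refl
    }

  pick-occurrence : ∀ y E → occurrences y E ≢ 0 → ∃₂ λ e R → occ y e ≢ 0 × E ≋ (e ∷ R)
  pick-occurrence y []      y∈E = ⊥-elim (y∈E refl)
  pick-occurrence y (e ∷ E) y∈E with occ y e ℕ.≟ 0
  ... | no  y∈e = e , E , y∈e , ≋-refl
  ... | yes y∉e with pick-occurrence y E (λ none → y∈E (cong₂ _+ℕ_ y∉e none))
  ...   | e′ , R , y∈e′ , E≋ = e′ , e ∷ R , y∈e′ , ≋-trans (≋-∷ e E≋) (↭⇒≋ (swap e e′ ↭-refl))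

  orient : ∀ y e E → occ y e ≢ 0 →
           e ≡ (y , y , label e) ⊎ ∃ λ o → o ≢ y × occ y e ≡ 1 × (e ∷ E) ≋ ((y , o , label e) ∷ E)
  orient y (t , s , c) E y∈e with t ≟ y | s ≟ y
  ... | yes refl | yes refl = inj₁ refl
  ... | yes refl | no s≢y   = inj₂ (s , s≢y , refl , ≋-refl)
  ... | no t≢y   | yes refl = inj₂ (t , t≢y , refl , swapEnds-≋ y t c E)
  ... | no _     | no _     = ⊥-elim (y∈e refl)

  occurs-once : ∀ y E → occurrences y E ≡ 1 →
    ∃₂ λ o d → ∃ λ R → o ≢ y × occurrences y R ≡ 0 × E ≋ ((y , o , d) ∷ R)
  occurs-once y E once with pick-occurrence y E (subst (_≢ 0) (sym once) λ ())
  ... | e , R , y∈e , E≋ with orient y e R y∈e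
  ...   | inj₁ refl with () ← trans (cong (_+ℕ occurrences y R) (sym (occ-loop y (label e))))
                                   (trans (sym (same-occurrences E≋ y)) once)
  ...   | inj₂ (o , o≢y , onceIn-e , e≋) =
    o , label e , R , o≢y ,
    ℕ.suc-injective (trans (cong (_+ℕ occurrences y R) (sym onceIn-e)) (trans (sym (same-occurrences E≋ y)) once)) ,
    ≋-trans E≋ e≋

  occurs-twice : ∀ y E → occurrences y E ≡ 2 →
    (∃₂ λ c R → occurrences y R ≡ 0 × E ≋ ((y , y , c) ∷ R)) ⊎
    (∃₂ λ o o′ → o ≢ y × o′ ≢ y × ∃₂ λ c d → ∃ λ R →
       occurrences y R ≡ 0 × E ≋ ((y , o , c) ∷ (y , o′ , d) ∷ R))
  occurs-twice y E twice with pick-occurrence y E (subst (_≢ 0) (sym twice) λ ())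
  ... | e , R , y∈e , E≋ with orient y e R y∈e
  ...   | inj₁ refl = inj₁ (label e , R , ℕ.+-cancelˡ-≡ 2 _ 0 split , E≋)
    where
    split = trans (cong (_+ℕ occurrences y R) (sym (occ-loop y (label e))))
                  (trans (sym (same-occurrences E≋ y)) twice)
  ...   | inj₂ (o , o≢y , onceIn-e , e≋) with occurs-once y R (ℕ.suc-injective split)
    where
    split = trans (cong (_+ℕ occurrences y R) (sym onceIn-e)) (trans (sym (same-occurrences E≋ y)) twice)
  ...     | o′ , d , R′ , o′≢y , none , R≋ =
    inj₂ (o , o′ , o≢y , o′≢y , label e , d , R′ , none , ≋-trans E≋ (≋-trans e≋ (≋-∷ _ R≋)))

_≟ᴴ_ : ∀ {n} → DecidableEquality (HalfEdge n)
(v , k) ≟ᴴ (v′ , k′) = map′ (uncurry (cong₂ _,_)) ,-injective (v Fin.≟ v′ ×-dec k Fin.≟ k′)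

_≟ᴱ_ : ∀ {n} → DecidableEquality (End n)
_≟ᴱ_ = Sum.≡-dec _≟ᴴ_ Fin._≟_

module _ {n : ℕ} where
  open Occurrences (_≟ᴱ_ {n}) public

open Occurrences (Fin._≟_ {4}) using () renaming (occurrences to occurrencesᶠ; δ to δᶠ)

rank : HalfEdge n → Fin (n *ℕ 4)
rank (v , k) = combine v k

rank-injective : ∀ {h h′ : HalfEdge n} → rank h ≡ rank h′ → h ≡ h′
rank-injective {h = v , k} {v′ , k′} e =
  trans (sym (Fin.remQuot-combine v k)) (trans (cong (remQuot 4) e) (Fin.remQuot-combine v′ k′))

_<ᴴ_ : HalfEdge n → HalfEdge n → Bool
h <ᴴ h′ = does (rank h Fin.<? rank h′)

<ᴴ-exactly-one : ∀ {h h′ : HalfEdge n} → h ≢ h′ → [ h <ᴴ h′ ] +ℕ [ h′ <ᴴ h ] ≡ 1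
<ᴴ-exactly-one {h = h} {h′} h≢h′ with Fin.<-cmp (rank h) (rank h′)
... | tri< h<h′ _ h′≮h rewrite dec-true (rank h Fin.<? rank h′) h<h′ | dec-false (rank h′ Fin.<? rank h) h′≮h = refl
... | tri≈ _ h≡h′ _ = ⊥-elim (h≢h′ (rank-injective h≡h′))
... | tri> h≮h′ _ h′<h rewrite dec-false (rank h Fin.<? rank h′) h≮h′ | dec-true (rank h′ Fin.<? rank h) h′<h = refl

isExternal : End n → Bool
isExternal (inj₁ _) = false
isExternal (inj₂ _) = true

-- Pairing functions

Pairing : Set
Pairing = Fin 6

pairingEqns : Pairing → List (Eqn (Fin 4))
pairingEqns 0F = (0F , 2F , true)  ∷ (1F , 3F , true)  ∷ []
pairingEqns 1F = (0F , 2F , false) ∷ (1F , 3F , false) ∷ []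
pairingEqns 2F = (0F , 3F , true)  ∷ (1F , 2F , true)  ∷ []
pairingEqns 3F = (0F , 3F , false) ∷ (1F , 2F , false) ∷ []
pairingEqns 4F = (0F , 1F , false) ∷ (2F , 3F , false) ∷ []
pairingEqns 5F = (0F , 1F , true)  ∷ (2F , 3F , true)  ∷ []

Flags : Set
Flags = Bool × Bool × Bool × Bool

pairingFlags : Pairing → Flags
pairingFlags 0F = (true  , true  , false , false)
pairingFlags 1F = (false , false , true  , true)
pairingFlags 2F = (true  , false , true  , false)
pairingFlags 3F = (false , true  , false , true)
pairingFlags 4F = (true  , false , false , true)
pairingFlags 5F = (false , true  , true  , false)

evalEV𝔹 : Flags → Bool → Bool → Bool → Bool → Bool
evalEV𝔹 (a , b , c , d) false false true  true  = a
evalEV𝔹 (a , b , c , d) true  true  false false = a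
evalEV𝔹 (a , b , c , d) false true  true  false = b
evalEV𝔹 (a , b , c , d) true  false false true  = b
evalEV𝔹 (a , b , c , d) false true  false true  = c
evalEV𝔹 (a , b , c , d) true  false true  false = c
evalEV𝔹 (a , b , c , d) false false false false = d
evalEV𝔹 (a , b , c , d) true  true  true  true  = d
evalEV𝔹 _ _ _ _ _ = false

bits : Bool → Bool → Bool → Bool → Fin 4 → Bool
bits b₀ b₁ b₂ b₃ = b₀ ∷ᵛ b₁ ∷ᵛ b₂ ∷ᵛ b₃ ∷ᵛ []ᵛ

∀𝔹? : {P : Bool → Set} → (∀ b → Dec (P b)) → Dec (∀ b → P b)
∀𝔹? P? = map′ (λ { (f , t) false → f ; (f , t) true → t }) (λ h → h false , h true) (P? false ×-dec P? true)

-- These finite checks are decided by evaluation; they are opaque so that their uses do not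
-- unfold the decision procedures.
opaque
  pairingFlags-correct : ∀ g b₀ b₁ b₂ b₃ →
    evalEV𝔹 (pairingFlags g) b₀ b₁ b₂ b₃ ≡ solves (bits b₀ b₁ b₂ b₃) (pairingEqns g)
  pairingFlags-correct = from-yes (Fin.all? λ g → ∀𝔹? λ b₀ → ∀𝔹? λ b₁ → ∀𝔹? λ b₂ → ∀𝔹? λ b₃ →
    evalEV𝔹 (pairingFlags g) b₀ b₁ b₂ b₃ 𝔹.≟ solves (bits b₀ b₁ b₂ b₃) (pairingEqns g))

  pairing-of-two-equations : ∀ i j k l c → (∀ m → occurrencesᶠ m ((i , j , c) ∷ (k , l , c) ∷ []) ≡ 1) →
    ∃ λ g → ∀ b₀ b₁ b₂ b₃ → solves (bits b₀ b₁ b₂ b₃) ((i , j , c) ∷ (k , l , c) ∷ []) ≡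
                             solves (bits b₀ b₁ b₂ b₃) (pairingEqns g)
  pairing-of-two-equations = from-yes (Fin.all? λ i → Fin.all? λ j → Fin.all? λ k → Fin.all? λ l → ∀𝔹? λ c →
    Fin.all? (λ m → occurrencesᶠ m ((i , j , c) ∷ (k , l , c) ∷ []) ℕ.≟ 1) →-dec
    Fin.any? λ g → ∀𝔹? λ b₀ → ∀𝔹? λ b₁ → ∀𝔹? λ b₂ → ∀𝔹? λ b₃ →
      solves (bits b₀ b₁ b₂ b₃) ((i , j , c) ∷ (k , l , c) ∷ []) 𝔹.≟ solves (bits b₀ b₁ b₂ b₃) (pairingEqns g))

  pairing-covers : ∀ g k → occurrencesᶠ k (pairingEqns g) ≡ 1
  pairing-covers = from-yes (Fin.all? λ g → Fin.all? λ k → occurrencesᶠ k (pairingEqns g) ℕ.≟ 1)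

solves-bits : ∀ (x : Fin 4 → Bool) E → solves x E ≡ solves (bits (x 0F) (x 1F) (x 2F) (x 3F)) E
solves-bits x = solves-cong pointwise
  where
  pointwise : ∀ i → x i ≡ bits (x 0F) (x 1F) (x 2F) (x 3F) i
  pointwise 0F = refl
  pointwise 1F = refl
  pointwise 2F = refl
  pointwise 3F = refl

pairing-even : ∀ g → labelParity (pairingEqns g) ≡ false
pairing-even 0F = refl
pairing-even 1F = refl
pairing-even 2F = refl
pairing-even 3F = refl
pairing-even 4F = refl
pairing-even 5F = refl

∑-δ : ∀ {m} (j : Fin m) (a : Fin m → ℕ) → ∑[ i < m ] ([ does (i Fin.≟ j) ] *ℕ a i) ≡ a j
∑-δ {suc m} zero    a = trans (cong₂ _+ℕ_ (ℕ.*-identityˡ (a zero)) (sum-replicate-zero m)) (ℕ.+-identityʳ (a zero))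
∑-δ {suc m} (suc j) a = ∑-δ j (λ i → a (suc i))

∑-δ₁ : ∀ {m} (j : Fin m) → ∑[ i < m ] [ does (i Fin.≟ j) ] ≡ 1
∑-δ₁ j = trans (sum-cong-≗ {x = λ i → [ does (i Fin.≟ j) ]} {y = λ i → [ does (i Fin.≟ j) ] *ℕ 1}
                           λ i → sym (ℕ.*-identityʳ _)) (∑-δ j (λ _ → 1))

∑-external : ∀ (e : End n) → ∑[ i < 4 ] δ (inj₂ i) e ≡ [ isExternal e ]
∑-external (inj₁ _) = refl
∑-external (inj₂ j) = ∑-δ₁ j

sum-map-concat : ∀ {X : Set} {m} (f : X → ℕ) (g : Fin m → List X) →
                 sum (map f (concat (tabulate g))) ≡ ∑[ i < m ] sum (map f (g i))
sum-map-concat {m = zero}  f g = refl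
sum-map-concat {m = suc m} f g = begin
  sum (map f (g zero ++ concat (tabulate (g ∘ suc))))              ≡⟨ cong sum (map-++ f (g zero) _) ⟩
  sum (map f (g zero) ++ map f (concat (tabulate (g ∘ suc))))      ≡⟨ sum-++ (map f (g zero)) _ ⟩
  sum (map f (g zero)) +ℕ sum (map f (concat (tabulate (g ∘ suc))))
    ≡⟨ cong (sum (map f (g zero)) +ℕ_) (sum-map-concat f (g ∘ suc)) ⟩
  sum (map f (g zero)) +ℕ ∑[ i < m ] sum (map f (g (suc i)))       ∎
  where open ≡-Reasoning

parityOf-++ : ∀ {X : Set} (f : X → Bool) xs ys → parityOf f (xs ++ ys) ≡ parityOf f xs xor parityOf f ys
parityOf-++ f []       ys = refl
parityOf-++ f (x ∷ xs) ys = trans (cong (f x xor_) (parityOf-++ f xs ys)) (sym (𝔹.xor-assoc (f x) _ _))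

parityOf-concat : ∀ {X : Set} {m} (f : X → Bool) (g : Fin m → List X) →
                  (∀ i → parityOf f (g i) ≡ false) → parityOf f (concat (tabulate g)) ≡ false
parityOf-concat {m = zero}  f g even = refl
parityOf-concat {m = suc m} f g even =
  trans (parityOf-++ f (g zero) _) (cong₂ _xor_ (even zero) (parityOf-concat f (g ∘ suc) (even ∘ suc)))

lengthParity : ∀ {X : Set} → List X → Bool
lengthParity = parityOf (λ _ → true)

⋃ᴴ : ∀ {X : Set} → (HalfEdge n → List X) → List X
⋃ᴴ f = concat (tabulate λ v → concat (tabulate λ k → f (v , k)))

opaque
  -- Opaque, so that unification treats ∑ᴴ f as rigid in f.
  ∑ᴴ : (HalfEdge n → ℕ) → ℕ
  ∑ᴴ {n} f = ∑[ v < n ] ∑[ k < 4 ] f (v , k)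

  ∑ᴴ-δ : ∀ (y : HalfEdge n) (a : HalfEdge n → ℕ) → ∑ᴴ (λ h → δ (inj₁ h) (inj₁ y) *ℕ a h) ≡ a y
  ∑ᴴ-δ {n} (w , l) a = trans (sum-cong-≗ atVertex) (∑-δ w (λ v → a (v , l)))
    where
    atVertex : ∀ v → ∑[ k < 4 ] (δ (inj₁ (v , k)) (inj₁ (w , l)) *ℕ a (v , k)) ≡ [ does (v Fin.≟ w) ] *ℕ a (v , l)
    atVertex v with v Fin.≟ w
    ... | yes refl = trans (∑-δ l (λ k → a (v , k))) (sym (ℕ.*-identityˡ (a (v , l))))
    ... | no  _    = sum-replicate-zero 4

  ∑ᴴ-cong : ∀ {f g : HalfEdge n → ℕ} → (∀ h → f h ≡ g h) → ∑ᴴ f ≡ ∑ᴴ g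
  ∑ᴴ-cong {n} {f} {g} f≗g = sum-cong-≗ {n} {x = λ v → ∑[ k < 4 ] f (v , k)} {y = λ v → ∑[ k < 4 ] g (v , k)}
    λ v → sum-cong-≗ {x = λ k → f (v , k)} {y = λ k → g (v , k)} λ k → f≗g (v , k)

  sum-map-⋃ᴴ : ∀ {X : Set} (f : X → ℕ) (g : HalfEdge n → List X) → sum (map f (⋃ᴴ g)) ≡ ∑ᴴ (λ h → sum (map f (g h)))
  sum-map-⋃ᴴ {n} f g = trans (sum-map-concat f (λ (v : Fin n) → concat (tabulate λ k → g (v , k))))
                              (sum-cong-≗ {n} λ v → sum-map-concat f (λ k → g (v , k)))

  ∑ᴴ-distrib-+ : ∀ (f g : HalfEdge n → ℕ) → ∑ᴴ (λ h → f h +ℕ g h) ≡ ∑ᴴ f +ℕ ∑ᴴ g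
  ∑ᴴ-distrib-+ {n} f g = trans (sum-cong-≗ {n} λ v → ∑-distrib-+ (λ k → f (v , k)) (λ k → g (v , k)))
                                (∑-distrib-+ (λ v → ∑[ k < 4 ] f (v , k)) (λ v → ∑[ k < 4 ] g (v , k)))

  ∑ᴴ-zero : ∑ᴴ {n} (λ _ → 0) ≡ 0
  ∑ᴴ-zero {n} = sum-replicate-zero n

parityOf-⋃ᴴ : ∀ {X : Set} (f : X → Bool) (g : HalfEdge n → List X) →
              (∀ h → parityOf f (g h) ≡ false) → parityOf f (⋃ᴴ g) ≡ false
parityOf-⋃ᴴ {n} f g even = parityOf-concat f (λ (v : Fin n) → concat (tabulate λ k → g (v , k)))
                             λ v → parityOf-concat f (λ k → g (v , k)) λ k → even (v , k)

halfEdges : List (HalfEdge n)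
halfEdges = ⋃ᴴ (_∷ [])

count : HalfEdge n → List (HalfEdge n) → ℕ
count y vs = sum (map (λ x → δ (inj₁ x) (inj₁ y)) vs)

count-halfEdges : ∀ (y : HalfEdge n) → count y halfEdges ≡ 1
count-halfEdges {n} y = begin
  count y halfEdges                                        ≡⟨ sum-map-⋃ᴴ (λ x → δ (inj₁ x) (inj₁ y)) (_∷ []) ⟩
  ∑ᴴ (λ h → δ (inj₁ h) (inj₁ y) +ℕ 0)                       ≡⟨ ∑ᴴ-cong (λ h → ℕ.+-identityʳ _) ⟩
  ∑ᴴ (λ h → δ (inj₁ h) (inj₁ y))                            ≡⟨ ∑ᴴ-cong (λ h → sym (ℕ.*-identityʳ _)) ⟩
  ∑ᴴ (λ h → δ (inj₁ h) (inj₁ y) *ℕ 1)                       ≡⟨ ∑ᴴ-δ y (λ _ → 1) ⟩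
  1                                                         ∎
  where open ≡-Reasoning

halfEdges-even : lengthParity (halfEdges {n}) ≡ false
halfEdges-even {n} = parityOf-concat (λ _ → true) (λ (v : Fin n) → concat (tabulate {n = 4} λ k → (v , k) ∷ [])) λ v → refl

weighted-δ : ∀ b d → (if b then d else 0) ≡ d *ℕ [ b ]
weighted-δ true  d = sym (ℕ.*-identityʳ d)
weighted-δ false d = sym (ℕ.*-zeroʳ d)

occurrences-++ : ∀ (y : End n) E F → occurrences y (E ++ F) ≡ occurrences y E +ℕ occurrences y F
occurrences-++ y E F = trans (cong sum (map-++ (occ y) E F)) (sum-++ (map (occ y) E) _)

-- Eliminating variables

-- Eliminating a variable changes the number of equality (label false) equations by one, so
-- its parity follows the number of variables still to be eliminated.
record Invariant (vs : List (HalfEdge n)) (E : List (Eqn (End n))) : Set where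
  field
    multiplicity  : ∀ y → count y vs ≤ℕ 1
    internal-twice : ∀ y → occurrences (inj₁ y) E ≡ 2 *ℕ count y vs
    external-once : ∀ i → occurrences (inj₂ i) E ≡ 1
    parity        : labelParity E ≡ lengthParity vs

Invariant-≋ : ∀ {vs : List (HalfEdge n)} {E F} → E ≋ F → Invariant vs E → Invariant vs F
Invariant-≋ E≋F inv = record
  { multiplicity   = multiplicity
  ; internal-twice = λ y → trans (sym (same-occurrences E≋F (inj₁ y))) (internal-twice y)
  ; external-once  = λ i → trans (sym (same-occurrences E≋F (inj₂ i))) (external-once i)
  ; parity         = trans (sym (same-parity E≋F)) parity
  }
  where open Invariant inv

data Elimination (x : HalfEdge n) (vs : List (HalfEdge n)) (E : List (Eqn (End n))) : Set where
  contradictory : ∀ R → E ≋ ((inj₁ x , inj₁ x , true) ∷ R) → Elimination x vs E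
  loop          : ∀ R → E ≋ ((inj₁ x , inj₁ x , false) ∷ R) → Invariant vs R → Elimination x vs E
  path          : ∀ o o′ c d R → o ≢ inj₁ x → o′ ≢ inj₁ x → occurrences (inj₁ x) R ≡ 0 →
                  E ≋ ((inj₁ x , o , c) ∷ (inj₁ x , o′ , d) ∷ R) →
                  Invariant vs ((o , o′ , c xor d) ∷ R) → Elimination x vs E

double-+ : ∀ a k → 2 *ℕ (a +ℕ k) ≡ (a +ℕ a) +ℕ 2 *ℕ k
double-+ = solve-∀

regroup : ∀ a p q r → (a +ℕ a) +ℕ ((p +ℕ q) +ℕ r) ≡ (a +ℕ p) +ℕ ((a +ℕ q) +ℕ r)
regroup = solve-∀

module _ {x : HalfEdge n} {vs : List (HalfEdge n)} where

  private
    multiplicity-tail : (∀ y → count y (x ∷ vs) ≤ℕ 1) → ∀ y → count y vs ≤ℕ 1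
    multiplicity-tail m y = ℕ.≤-trans (ℕ.m≤n+m (count y vs) _) (m y)

    not-injective : ∀ {a b} → not a ≡ not b → a ≡ b
    not-injective {false} {false} _ = refl
    not-injective {true}  {true}  _ = refl

  loop-invariant : ∀ R → Invariant (x ∷ vs) ((inj₁ x , inj₁ x , false) ∷ R) → Invariant vs R
  loop-invariant R inv = record
    { multiplicity   = multiplicity-tail multiplicity
    ; internal-twice = λ y → cancel (δ (inj₁ x) (inj₁ y)) _ _ (internal-twice y)
    ; external-once  = external-once
    ; parity         = not-injective parity
    }
    where
    open Invariant inv
    cancel : ∀ a r k → (a +ℕ a) +ℕ r ≡ 2 *ℕ (a +ℕ k) → r ≡ 2 *ℕ k
    cancel a r k h = ℕ.+-cancelˡ-≡ (a +ℕ a) r (2 *ℕ k) (trans h (double-+ a k))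

  path-invariant : ∀ o o′ c d R → Invariant (x ∷ vs) ((inj₁ x , o , c) ∷ (inj₁ x , o′ , d) ∷ R) →
                   Invariant vs ((o , o′ , c xor d) ∷ R)
  path-invariant o o′ c d R inv = record
    { multiplicity   = multiplicity-tail multiplicity
    ; internal-twice = λ y → cancel (δ (inj₁ x) (inj₁ y)) _ _ _ _ (internal-twice y)
    ; external-once  = λ i → trans (ℕ.+-assoc (δ o (inj₂ i)) _ _) (external-once i)
    ; parity         = not-injective (trans (sym (merge c d _)) parity)
    }
    where
    open Invariant inv
    cancel : ∀ a p q r k → (a +ℕ p) +ℕ ((a +ℕ q) +ℕ r) ≡ 2 *ℕ (a +ℕ k) → (p +ℕ q) +ℕ r ≡ 2 *ℕ k
    cancel a p q r k h = ℕ.+-cancelˡ-≡ (a +ℕ a) _ _ (trans (regroup a p q r) (trans h (double-+ a k)))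
    merge : ∀ c d P → not c xor not d xor P ≡ not (not (c xor d) xor P)
    merge false false P = refl
    merge false true  P = refl
    merge true  false P = refl
    merge true  true  P = sym (𝔹.not-involutive P)

  eliminate : ∀ {E} → Invariant (x ∷ vs) E → Elimination x vs E
  eliminate {E} inv with occurs-twice (inj₁ x) E twice
    where
    open Invariant inv
    twice : occurrences (inj₁ x) E ≡ 2
    twice = trans (internal-twice x) (cong (2 *ℕ_) (ℕ.≤-antisym (multiplicity x) (ℕ.≤-trans
              (ℕ.≤-reflexive (sym (δ-refl (inj₁ x)))) (ℕ.m≤m+n _ (count x vs)))))
  ... | inj₁ (true  , R , _ , E≋) = contradictory R E≋
  ... | inj₁ (false , R , _ , E≋) = loop R E≋ (loop-invariant R (Invariant-≋ E≋ inv))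
  ... | inj₂ (o , o′ , o≢x , o′≢x , c , d , R , x∉R , E≋) =
    path o o′ c d R o≢x o′≢x x∉R E≋ (path-invariant o o′ c d R (Invariant-≋ E≋ inv))

external-only : ∀ (E : List (Eqn (End n))) → (∀ y → occurrences (inj₁ y) E ≡ 0) →
                ∃ λ E′ → E ≡ map (mapEqn inj₂) E′
external-only []                          none = [] , refl
external-only ((inj₁ y , s , c) ∷ E)      none
  with () ← trans (sym (δ-refl (inj₁ y))) (ℕ.m+n≡0⇒m≡0 _ (ℕ.m+n≡0⇒m≡0 _ (none y)))
external-only ((inj₂ i , inj₁ y , c) ∷ E) none
  with () ← trans (sym (δ-refl (inj₁ y))) (ℕ.m+n≡0⇒m≡0 _ (none y))
external-only ((inj₂ i , inj₂ j , c) ∷ E) none with external-only E (λ y → ℕ.m+n≡0⇒n≡0 0 (none y))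
... | E′ , refl = (i , j , c) ∷ E′ , refl

occurrences-external : ∀ m (E′ : List (Eqn (Fin 4))) →
                       occurrences {n} (inj₂ m) (map (mapEqn inj₂) E′) ≡ occurrencesᶠ m E′
occurrences-external m []       = refl
occurrences-external m (e ∷ E′) = cong (_ +ℕ_) (occurrences-external m E′)

total-occurrences : ∀ (E′ : List (Eqn (Fin 4))) → ∑[ m < 4 ] occurrencesᶠ m E′ ≡ 2 *ℕ length E′
total-occurrences []                = refl
total-occurrences ((t , s , c) ∷ E′) =
  trans (∑-distrib-+ (λ m → δᶠ t m +ℕ δᶠ s m) (λ m → occurrencesᶠ m E′))
        (trans (cong₂ _+ℕ_ (two-ends t s) (total-occurrences E′)) (sym (ℕ.*-suc 2 (length E′))))
  where
  two-ends : ∀ t s → ∑[ m < 4 ] (δᶠ t m +ℕ δᶠ s m) ≡ 2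
  two-ends = from-yes (Fin.all? λ t → Fin.all? λ s → ∑[ m < 4 ] (δᶠ t m +ℕ δᶠ s m) ℕ.≟ 2)

two-equations : ∀ (E′ : List (Eqn (Fin 4))) → (∀ m → occurrencesᶠ m E′ ≡ 1) → labelParity E′ ≡ false →
                ∃₂ λ i j → ∃₂ λ k l → ∃ λ c → E′ ≡ (i , j , c) ∷ (k , l , c) ∷ []
two-equations E′ once even = shape E′ length≡2 even
  where
  length≡2 : length E′ ≡ 2
  length≡2 = ℕ.*-cancelˡ-≡ (length E′) 2 2 (trans (sym (total-occurrences E′)) (sum-cong-≗ once))
  shape : ∀ E′ → length E′ ≡ 2 → labelParity E′ ≡ false →
          ∃₂ λ i j → ∃₂ λ k l → ∃ λ c → E′ ≡ (i , j , c) ∷ (k , l , c) ∷ []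
  shape ((i , j , false) ∷ (k , l , false) ∷ []) refl _ = i , j , k , l , false , refl
  shape ((i , j , true)  ∷ (k , l , true)  ∷ []) refl _ = i , j , k , l , true , refl
  shape ((i , j , false) ∷ (k , l , true)  ∷ []) refl ()
  shape ((i , j , true)  ∷ (k , l , false) ∷ []) refl ()

pairing-of-external-system : ∀ {E : List (Eqn (End n))} → Invariant [] E →
                ∃ λ g → ∀ ν → solves ν E ≡ solves (ν ∘ inj₂) (pairingEqns g)
pairing-of-external-system {n} {E} inv with external-only E internal-twice
  where open Invariant inv
... | E′ , refl with two-equations E′ (λ m → trans (sym (occurrences-external m E′)) (external-once m))
                                      (trans (sym (labelParity-map inj₂ E′)) parity)
  where open Invariant inv
...   | i , j , k , l , c , refl
  with pairing-of-two-equations i j k l c (λ m → trans (sym (occurrences-external {n} m ((i , j , c) ∷ (k , l , c) ∷ [])))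
                                         (external-once m))
  where open Invariant inv
...     | g , agree = g , λ ν → let x = ν ∘ inj₂ in begin
  solves ν (map (mapEqn inj₂) E₂)                ≡⟨ solves-map inj₂ ν E₂ ⟩
  solves x E₂                                    ≡⟨ solves-bits x E₂ ⟩
  solves (bits (x 0F) (x 1F) (x 2F) (x 3F)) E₂   ≡⟨ agree (x 0F) (x 1F) (x 2F) (x 3F) ⟩
  solves (bits (x 0F) (x 1F) (x 2F) (x 3F)) (pairingEqns g) ≡⟨ solves-bits x (pairingEqns g) ⟨
  solves x (pairingEqns g)                       ∎
  where open ≡-Reasoning
        E₂ = (i , j , c) ∷ (k , l , c) ∷ []

-- The equation system of a construction

at : Fin n → Fin 4 → End n
at v k = inj₁ (v , k)

δ-at-vertex : ∀ (v : Fin n) i k → δ (at v i) (at v k) ≡ δᶠ i k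
δ-at-vertex v i k rewrite dec-true (v Fin.≟ v) refl = refl

occurrences-at-vertex : ∀ (v : Fin n) k E → occurrences (at v k) (map (mapEqn (at v)) E) ≡ occurrencesᶠ k E
occurrences-at-vertex v k []              = refl
occurrences-at-vertex v k ((i , j , c) ∷ E) =
  cong₂ _+ℕ_ (cong₂ _+ℕ_ (δ-at-vertex v i k) (δ-at-vertex v j k)) (occurrences-at-vertex v k E)

occurrences-other-vertex : ∀ {v w : Fin n} k E → v ≢ w → occurrences (at w k) (map (mapEqn (at v)) E) ≡ 0
occurrences-other-vertex k []              v≢w = refl
occurrences-other-vertex {v = v} {w} k ((i , j , c) ∷ E) v≢w
  rewrite dec-false (v Fin.≟ w) v≢w = occurrences-other-vertex k E v≢w

occurrences-external-at-vertex : ∀ (v : Fin n) i E → occurrences (inj₂ i) (map (mapEqn (at v)) E) ≡ 0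
occurrences-external-at-vertex v i []      = refl
occurrences-external-at-vertex v i (e ∷ E) = occurrences-external-at-vertex v i E

module ConstructionSystem (Γ : Construction n) where
  open Construction Γ

  attach : Fin 4 → HalfEdge n
  attach i = proj₁ (dangling i)

  match-attach : ∀ i → match (inj₁ (attach i)) ≡ inj₂ i
  match-attach i = trans (cong match (sym (proj₂ (dangling i)))) (involutive (inj₂ i))

  -- The two ends of an internal edge carry opposite bits, a dangling edge carries β i to its end.
  edgeEqn : HalfEdge n → Eqn (End n)
  edgeEqn h = inj₁ h , match (inj₁ h) , not (isExternal (match (inj₁ h)))

  -- Each internal edge is listed once, from its smaller end.
  precedes : HalfEdge n → End n → Bool
  precedes h (inj₁ h′) = h <ᴴ h′
  precedes h (inj₂ _)  = false

  represents : HalfEdge n → Bool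
  represents h = precedes h (match (inj₁ h))

  danglingEqns : List (Eqn (End n))
  danglingEqns = concat (tabulate λ i → edgeEqn (attach i) ∷ [])

  internalEqns : List (Eqn (End n))
  internalEqns = ⋃ᴴ λ h → if represents h then edgeEqn h ∷ [] else []

  vertexEqns : (Fin n → Pairing) → List (Eqn (End n))
  vertexEqns g = concat (tabulate λ v → map (mapEqn (at v)) (pairingEqns (g v)))

  system : (Fin n → Pairing) → List (Eqn (End n))
  system g = vertexEqns g ++ (danglingEqns ++ internalEqns)

  occ-edgeEqn : ∀ h y → occ y (edgeEqn h) ≡ δ (inj₁ h) y +ℕ δ (inj₁ h) (match y)
  occ-edgeEqn h y = cong (δ (inj₁ h) y +ℕ_) (δ-involution match involutive (inj₁ h) y)

  represented : End n → ℕ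
  represented (inj₁ h) = [ represents h ]
  represented (inj₂ _) = 0

  ∑ᴴ-represents : ∀ e → ∑ᴴ (λ h → if represents h then δ (inj₁ h) e else 0) ≡ represented e
  ∑ᴴ-represents (inj₁ y) = trans (∑ᴴ-cong λ h → weighted-δ (represents h) _) (∑ᴴ-δ y (λ h → [ represents h ]))
  ∑ᴴ-represents (inj₂ i) = trans (∑ᴴ-cong λ h → zero-either (represents h)) ∑ᴴ-zero
    where
    zero-either : ∀ b → (if b then 0 else 0) ≡ 0
    zero-either true  = refl
    zero-either false = refl

  occurrences-internal : ∀ y → occurrences y internalEqns ≡ represented y +ℕ represented (match y)
  occurrences-internal y = begin
    occurrences y internalEqns
      ≡⟨ sum-map-⋃ᴴ (occ y) (λ h → if represents h then edgeEqn h ∷ [] else []) ⟩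
    ∑ᴴ (λ h → occurrences y (if represents h then edgeEqn h ∷ [] else []))
      ≡⟨ ∑ᴴ-cong (λ h → split (represents h) h) ⟩
    ∑ᴴ (λ h → (if represents h then δ (inj₁ h) y else 0) +ℕ (if represents h then δ (inj₁ h) (match y) else 0))
      ≡⟨ ∑ᴴ-distrib-+ (λ h → if represents h then δ (inj₁ h) y else 0)
                      (λ h → if represents h then δ (inj₁ h) (match y) else 0) ⟩
    ∑ᴴ (λ h → if represents h then δ (inj₁ h) y else 0) +ℕ ∑ᴴ (λ h → if represents h then δ (inj₁ h) (match y) else 0)
      ≡⟨ cong₂ _+ℕ_ (∑ᴴ-represents y) (∑ᴴ-represents (match y)) ⟩
    represented y +ℕ represented (match y) ∎
    where
    open ≡-Reasoning
    split : ∀ b h → occurrences y (if b then edgeEqn h ∷ [] else []) ≡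
                    (if b then δ (inj₁ h) y else 0) +ℕ (if b then δ (inj₁ h) (match y) else 0)
    split true  h = trans (ℕ.+-identityʳ _) (occ-edgeEqn h y)
    split false h = refl

  occurrences-dangling : ∀ y → occurrences y danglingEqns ≡ [ isExternal (match y) ] +ℕ [ isExternal y ]
  occurrences-dangling y = begin
    occurrences y danglingEqns
      ≡⟨ sum-map-concat (occ y) (λ i → edgeEqn (attach i) ∷ []) ⟩
    ∑[ i < 4 ] (occ y (edgeEqn (attach i)) +ℕ 0)
      ≡⟨ sum-cong-≗ {x = λ i → occ y (edgeEqn (attach i)) +ℕ 0} {y = λ i → δ (inj₂ i) (match y) +ℕ δ (inj₂ i) y} ends ⟩
    ∑[ i < 4 ] (δ (inj₂ i) (match y) +ℕ δ (inj₂ i) y)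
      ≡⟨ ∑-distrib-+ (λ i → δ (inj₂ i) (match y)) (λ i → δ (inj₂ i) y) ⟩
    ∑[ i < 4 ] δ (inj₂ i) (match y) +ℕ ∑[ i < 4 ] δ (inj₂ i) y
      ≡⟨ cong₂ _+ℕ_ (∑-external (match y)) (∑-external y) ⟩
    [ isExternal (match y) ] +ℕ [ isExternal y ] ∎
    where
    open ≡-Reasoning
    ends : ∀ i → occ y (edgeEqn (attach i)) +ℕ 0 ≡ δ (inj₂ i) (match y) +ℕ δ (inj₂ i) y
    ends i = begin
      occ y (edgeEqn (attach i)) +ℕ 0                        ≡⟨ ℕ.+-identityʳ _ ⟩
      δ (inj₁ (attach i)) y +ℕ δ (match (inj₁ (attach i))) y
        ≡⟨ cong₂ (λ a b → δ a y +ℕ δ b y) (sym (proj₂ (dangling i))) (match-attach i) ⟩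
      δ (match (inj₂ i)) y +ℕ δ (inj₂ i) y
        ≡⟨ cong (_+ℕ δ (inj₂ i) y) (δ-involution match involutive (inj₂ i) y) ⟩
      δ (inj₂ i) (match y) +ℕ δ (inj₂ i) y                   ∎

  occurrences-vertices : ∀ g y → occurrences (inj₁ y) (vertexEqns g) ≡ 1
  occurrences-vertices g (w , l) =
    trans (sum-map-concat (occ (inj₁ (w , l))) (λ v → map (mapEqn (at v)) (pairingEqns (g v))))
          (trans (sum-cong-≗ {x = λ v → occurrences (at w l) (map (mapEqn (at v)) (pairingEqns (g v)))}
                             {y = λ v → [ does (v Fin.≟ w) ]} atVertex)
                 (∑-δ₁ w))
    where
    atVertex : ∀ v → occurrences (at w l) (map (mapEqn (at v)) (pairingEqns (g v))) ≡ [ does (v Fin.≟ w) ]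
    atVertex v with v Fin.≟ w
    ... | yes refl = trans (occurrences-at-vertex v l (pairingEqns (g v))) (pairing-covers (g v) l)
    ... | no  v≢w  = occurrences-other-vertex l (pairingEqns (g v)) v≢w

  occurrences-vertices-external : ∀ g i → occurrences (inj₂ i) (vertexEqns g) ≡ 0
  occurrences-vertices-external g i =
    trans (sum-map-concat (occ (inj₂ i)) (λ v → map (mapEqn (at v)) (pairingEqns (g v))))
          (trans (sum-cong-≗ {x = λ v → occurrences (inj₂ i) (map (mapEqn (at v)) (pairingEqns (g v)))}
                             {y = λ _ → 0} λ v → occurrences-external-at-vertex v i (pairingEqns (g v)))
                 (sum-replicate-zero n))

  edges-internal : ∀ y → occurrences (inj₁ y) (danglingEqns ++ internalEqns) ≡ 1
  edges-internal y = trans (occurrences-++ (inj₁ y) danglingEqns internalEqns)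
    (trans (cong₂ _+ℕ_ (occurrences-dangling (inj₁ y)) (occurrences-internal (inj₁ y))) (byPartner _ refl))
    where
    byPartner : ∀ e → match (inj₁ y) ≡ e → [ isExternal e ] +ℕ 0 +ℕ ([ precedes y e ] +ℕ represented e) ≡ 1
    byPartner (inj₂ i)  _  = refl
    byPartner (inj₁ y′) eq =
      trans (cong (λ e → [ y <ᴴ y′ ] +ℕ [ precedes y′ e ]) (trans (cong match (sym eq)) (involutive (inj₁ y))))
            (<ᴴ-exactly-one {h = y} {h′ = y′} λ { refl → noFix (inj₁ y) eq })

  edges-external : ∀ i → occurrences (inj₂ i) (danglingEqns ++ internalEqns) ≡ 1
  edges-external i = trans (occurrences-++ (inj₂ i) danglingEqns internalEqns)
    (trans (cong₂ _+ℕ_ (occurrences-dangling (inj₂ i)) (occurrences-internal (inj₂ i))) (byAttachment (match (inj₂ i)) refl))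
    where
    byAttachment : ∀ e → match (inj₂ i) ≡ e → [ isExternal e ] +ℕ 1 +ℕ (0 +ℕ represented e) ≡ 1
    byAttachment (inj₁ h) eq with refl ← trans (sym (proj₂ (dangling i))) eq =
      cong (λ e → 1 +ℕ [ precedes (attach i) e ]) (match-attach i)
    byAttachment (inj₂ j) eq with () ← trans (sym (proj₂ (dangling i))) eq

  dangling-even : labelParity danglingEqns ≡ false
  dangling-even rewrite match-attach 0F | match-attach 1F | match-attach 2F | match-attach 3F = refl

  internal-even : labelParity internalEqns ≡ false
  internal-even = parityOf-⋃ᴴ (not ∘ label) (λ h → if represents h then edgeEqn h ∷ [] else [])
                              (λ h → kept-even h (match (inj₁ h)))
    where
    kept-even : ∀ h e → labelParity (if precedes h e then (inj₁ h , e , not (isExternal e)) ∷ [] else []) ≡ false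
    kept-even h (inj₂ _) = refl
    kept-even h (inj₁ h′) with h <ᴴ h′
    ... | true  = refl
    ... | false = refl

  system-even : ∀ g → labelParity (system g) ≡ false
  system-even g = trans (parityOf-++ (not ∘ label) (vertexEqns g) _)
    (cong₂ _xor_ (parityOf-concat (not ∘ label) (λ v → map (mapEqn (at v)) (pairingEqns (g v)))
                                  λ v → trans (labelParity-map (at v) (pairingEqns (g v))) (pairing-even (g v)))
                 (trans (parityOf-++ (not ∘ label) danglingEqns internalEqns) (cong₂ _xor_ dangling-even internal-even)))

  initial-invariant : ∀ g → Invariant halfEdges (system g)
  initial-invariant g = record
    { multiplicity   = λ y → ℕ.≤-reflexive (count-halfEdges y)
    ; internal-twice = λ y → trans (occurrences-++ (inj₁ y) (vertexEqns g) _)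
        (trans (cong₂ _+ℕ_ (occurrences-vertices g y) (edges-internal y)) (cong (2 *ℕ_) (sym (count-halfEdges y))))
    ; external-once  = λ i → trans (occurrences-++ (inj₂ i) (vertexEqns g) _)
        (cong₂ _+ℕ_ (occurrences-vertices-external g i) (edges-external i))
    ; parity         = trans (system-even g) (sym (halfEdges-even {n}))
    }

Assignment : ℕ → Set
Assignment n = Fin n → Fin 4 → Bool

flipAt : ∀ {n} → HalfEdge n → Assignment n → Assignment n
flipAt (v , k) σ = updateAt σ v (λ row → updateAt row k not)

flipAt-self : ∀ {n} (v : Fin n) k σ → flipAt (v , k) σ v k ≡ not (σ v k)
flipAt-self v k σ = trans (cong (λ row → row k) (updateAt-updates v σ)) (updateAt-updates k (σ v))

flipAt-other : ∀ {n} {v w : Fin n} {k l} σ → (w , l) ≢ (v , k) → flipAt (v , k) σ w l ≡ σ w l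
flipAt-other {v = v} {w} {k} {l} σ wl≢vk with w Fin.≟ v
... | yes refl = trans (cong (λ row → row l) (updateAt-updates v σ))
                       (updateAt-minimal l k (σ v) (λ l≡k → wl≢vk (cong (v ,_) l≡k)))
... | no  w≢v  = cong (λ row → row l) (updateAt-minimal w v σ w≢v)

value : ∀ {n} → Assignment n → (Fin 4 → Bool) → End n → Bool
value σ β (inj₁ (v , k)) = σ v k
value σ β (inj₂ i)       = β i

value-cong : ∀ {n} {σ τ : Assignment n} β → (∀ v k → σ v k ≡ τ v k) → ∀ e → value σ β e ≡ value τ β e
value-cong β σ≗τ (inj₁ (v , k)) = σ≗τ v k
value-cong β σ≗τ (inj₂ i)       = refl

value-flipAt-other : ∀ {n} (x : HalfEdge n) σ β e → e ≢ inj₁ x → value (flipAt x σ) β e ≡ value σ β e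
value-flipAt-other x σ β (inj₁ h) h≢x = flipAt-other σ (λ h≡x → h≢x (cong inj₁ h≡x))
value-flipAt-other x σ β (inj₂ i) _   = refl

solves-flipAt-unaffected : ∀ {n} (x : HalfEdge n) σ β R → occurrences (inj₁ x) R ≡ 0 →
                           solves (value (flipAt x σ) β) R ≡ solves (value σ β) R
solves-flipAt-unaffected x σ β []              _    = refl
solves-flipAt-unaffected x σ β ((t , s , c) ∷ R) none =
  cong₂ _∧_ (cong₂ (λ a b → not (a xor b xor c)) (value-flipAt-other x σ β t (δ≡0⇒≢ t≠))
                                                  (value-flipAt-other x σ β s (δ≡0⇒≢ s≠)))
            (solves-flipAt-unaffected x σ β R (ℕ.m+n≡0⇒n≡0 (occ (inj₁ x) (t , s , c)) none))
  where
  t≠ = ℕ.m+n≡0⇒m≡0 _ (ℕ.m+n≡0⇒m≡0 _ none)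
  s≠ = ℕ.m+n≡0⇒n≡0 (δ t (inj₁ x)) (ℕ.m+n≡0⇒m≡0 _ none)

pathHolds : (u a b c d r : Bool) → Bool
pathHolds u a b c d r = not (u xor a xor c) ∧ (not (u xor b xor d) ∧ r)

opaque
  merge-path : ∀ u a b c d r →
    pathHolds u a b c d r ∧ pathHolds (not u) a b c d r ≡ false ×
    pathHolds u a b c d r ∨ pathHolds (not u) a b c d r ≡ not (a xor b xor (c xor d)) ∧ r
  merge-path = from-yes (∀𝔹? λ u → ∀𝔹? λ a → ∀𝔹? λ b → ∀𝔹? λ c → ∀𝔹? λ d → ∀𝔹? λ r →
    (pathHolds u a b c d r ∧ pathHolds (not u) a b c d r 𝔹.≟ false) ×-dec
    (pathHolds u a b c d r ∨ pathHolds (not u) a b c d r 𝔹.≟ not (a xor b xor (c xor d)) ∧ r))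

module Reals (ℝ : RealModel) where
  open RealModel ℝ public
  open IsCommutativeRing isCommutativeRing public
    using (+-comm; +-assoc; +-identityˡ; +-identityʳ; *-comm; *-assoc; *-identityˡ; *-identityʳ;
           zeroˡ; zeroʳ; distribˡ; distribʳ; -‿inverseʳ)
  open IsTotalOrder isTotalOrder public using (total; antisym) renaming (refl to ≤-refl; trans to ≤-trans)

  commutativeRing : CommutativeRing _ _
  commutativeRing = record { isCommutativeRing = isCommutativeRing }

  almostCommutativeRing : AlmostCommutativeRing _ _
  almostCommutativeRing = fromCommutativeRing commutativeRing (λ _ → nothing)

  open import Tactic.RingSolver.NonReflective almostCommutativeRing public
    using (solve; _⊜_; _⊕_; _⊗_)
  open RingProperties (CommutativeRing.ring commutativeRing) public
    using (-‿distribˡ-*; -‿involutive; xyx⁻¹≈y; +-cancelʳ)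

  x+[y-x]≡y : ∀ x y → x + (y + - x) ≡ y
  x+[y-x]≡y x y = trans (sym (+-assoc x y (- x))) (xyx⁻¹≈y x y)

  ≤-respects : ∀ {x y x′ y′} → x ≡ x′ → y ≡ y′ → x ≤ y → x′ ≤ y′
  ≤-respects refl refl x≤y = x≤y

  +-monoʳ : ∀ {x y} z → x ≤ y → z + x ≤ z + y
  +-monoʳ {x} {y} z x≤y = ≤-respects (+-comm x z) (+-comm y z) (+-monoˡ z x≤y)

  +-mono : ∀ {x y u v} → x ≤ y → u ≤ v → x + u ≤ y + v
  +-mono {y = y} {u} x≤y u≤v = ≤-trans (+-monoˡ u x≤y) (+-monoʳ y u≤v)

  +-nonneg : ∀ {x y} → 0# ≤ x → 0# ≤ y → 0# ≤ x + y
  +-nonneg 0≤x 0≤y = ≤-respects (+-identityˡ 0#) refl (+-mono 0≤x 0≤y)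

  x≤x+y : ∀ {x y} → 0# ≤ y → x ≤ x + y
  x≤x+y {x} 0≤y = ≤-respects (+-identityʳ x) refl (+-monoʳ x 0≤y)

  difference-nonneg : ∀ {x y} → x ≤ y → 0# ≤ y + - x
  difference-nonneg {x} x≤y = ≤-respects (-‿inverseʳ x) refl (+-monoˡ (- x) x≤y)

  *-monoˡ : ∀ {k x y} → 0# ≤ k → x ≤ y → k * x ≤ k * y
  *-monoˡ {k} {x} {y} 0≤k x≤y = ≤-respects (+-identityʳ (k * x)) (trans (sym (distribˡ k x (y + - x))) (cong (k *_) (x+[y-x]≡y x y)))
    (+-monoʳ (k * x) (*-nonneg 0≤k (difference-nonneg x≤y)))

  0≤1 : 0# ≤ 1#
  0≤1 with total 0# 1#
  ... | inj₁ 0≤1 = 0≤1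
  ... | inj₂ 1≤0 = ≤-respects refl square (*-nonneg 0≤-1 0≤-1)
    where
    0≤-1 : 0# ≤ - 1#
    0≤-1 = ≤-respects (-‿inverseʳ 1#) (+-identityˡ (- 1#)) (+-monoˡ (- 1#) 1≤0)
    square : - 1# * - 1# ≡ 1#
    square = trans (sym (-‿distribˡ-* 1# (- 1#))) (trans (cong -_ (*-identityˡ (- 1#))) (-‿involutive 1#))

  two : Carrier
  two = 1# + 1#

  two≢0 : ¬ (two ≡ 0#)
  two≢0 two≡0 = 0≢1 (antisym 0≤1 (≤-respects refl two≡0 (x≤x+y 0≤1)))

  half : Carrier
  half = proj₁ (inverse two two≢0)

  two*half : two * half ≡ 1#
  two*half = proj₂ (inverse two two≢0)

  half-nonneg : 0# ≤ half
  half-nonneg with total 0# half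
  ... | inj₁ 0≤half = 0≤half
  ... | inj₂ half≤0 = ⊥-elim (0≢1 (antisym 0≤1
          (≤-respects two*half (zeroʳ two) (*-monoˡ (+-nonneg 0≤1 0≤1) half≤0))))

  half-double : ∀ x → half * (x + x) ≡ x
  half-double x = begin
    half * (x + x)          ≡⟨ cong (half *_) (sym (trans (distribʳ x 1# 1#) (cong₂ _+_ (*-identityˡ x) (*-identityˡ x)))) ⟩
    half * (two * x)        ≡⟨ sym (*-assoc half two x) ⟩
    half * two * x          ≡⟨ cong (_* x) (trans (*-comm half two) two*half) ⟩
    1# * x                  ≡⟨ *-identityˡ x ⟩
    x                       ∎
    where open ≡-Reasoning

  ⟦_⟧ : Bool → Carrier
  ⟦ true  ⟧ = 1#
  ⟦ false ⟧ = 0#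

  ⟦⟧-nonneg : ∀ b → 0# ≤ ⟦ b ⟧
  ⟦⟧-nonneg true  = 0≤1
  ⟦⟧-nonneg false = ≤-refl

  ⟦∧⟧ : ∀ a b → ⟦ a ∧ b ⟧ ≡ ⟦ a ⟧ * ⟦ b ⟧
  ⟦∧⟧ true  b = sym (*-identityˡ ⟦ b ⟧)
  ⟦∧⟧ false b = sym (zeroˡ ⟦ b ⟧)

  ⟦∨⟧-disjoint : ∀ a b → a ∧ b ≡ false → ⟦ a ⟧ + ⟦ b ⟧ ≡ ⟦ a ∨ b ⟧
  ⟦∨⟧-disjoint true  false _ = +-identityʳ 1#
  ⟦∨⟧-disjoint false b     _ = +-identityˡ ⟦ b ⟧

  ⟦_⟧ᴾ : Flags → Params ℝ
  ⟦ a , b , c , d ⟧ᴾ = ⟦ a ⟧ , ⟦ b ⟧ , ⟦ c ⟧ , ⟦ d ⟧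

  pairingParams : Pairing → Params ℝ
  pairingParams g = ⟦ pairingFlags g ⟧ᴾ

  evalEV-⟦⟧ : ∀ fl b₀ b₁ b₂ b₃ → evalEV ℝ ⟦ fl ⟧ᴾ b₀ b₁ b₂ b₃ ≡ ⟦ evalEV𝔹 fl b₀ b₁ b₂ b₃ ⟧
  evalEV-⟦⟧ fl false false false false = refl
  evalEV-⟦⟧ fl false false false true  = refl
  evalEV-⟦⟧ fl false false true  false = refl
  evalEV-⟦⟧ fl false false true  true  = refl
  evalEV-⟦⟧ fl false true  false false = refl
  evalEV-⟦⟧ fl false true  false true  = refl
  evalEV-⟦⟧ fl false true  true  false = refl
  evalEV-⟦⟧ fl false true  true  true  = refl
  evalEV-⟦⟧ fl true  false false false = refl
  evalEV-⟦⟧ fl true  false false true  = refl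
  evalEV-⟦⟧ fl true  false true  false = refl
  evalEV-⟦⟧ fl true  false true  true  = refl
  evalEV-⟦⟧ fl true  true  false false = refl
  evalEV-⟦⟧ fl true  true  false true  = refl
  evalEV-⟦⟧ fl true  true  true  false = refl
  evalEV-⟦⟧ fl true  true  true  true  = refl

  eightVertex-pairing : ∀ g x → eightVertex ℝ (pairingParams g) x ≡ ⟦ solves x (pairingEqns g) ⟧
  eightVertex-pairing g x = trans (evalEV-⟦⟧ (pairingFlags g) (x 0F) (x 1F) (x 2F) (x 3F))
    (cong ⟦_⟧ (trans (pairingFlags-correct g (x 0F) (x 1F) (x 2F) (x 3F)) (sym (solves-bits x (pairingEqns g)))))

  prodV-cong : ∀ {m} {f g : Fin m → Carrier} → (∀ v → f v ≡ g v) → prodV ℝ m f ≡ prodV ℝ m g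
  prodV-cong {zero}  f≗g = refl
  prodV-cong {suc m} f≗g = cong₂ _*_ (f≗g zero) (prodV-cong (f≗g ∘ suc))

  prodV-* : ∀ m (f g : Fin m → Carrier) → prodV ℝ m (λ v → f v * g v) ≡ prodV ℝ m f * prodV ℝ m g
  prodV-* zero    f g = sym (*-identityˡ 1#)
  prodV-* (suc m) f g = trans (cong (f zero * g zero *_) (prodV-* m (f ∘ suc) (g ∘ suc)))
    (solve 4 (λ a b c d → ((a ⊗ b) ⊗ (c ⊗ d)) ⊜ ((a ⊗ c) ⊗ (b ⊗ d))) refl (f zero) (g zero) _ _)

  prodV-nonneg : ∀ m (f : Fin m → Carrier) → (∀ v → 0# ≤ f v) → 0# ≤ prodV ℝ m f
  prodV-nonneg zero    f 0≤f = 0≤1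
  prodV-nonneg (suc m) f 0≤f = *-nonneg (0≤f zero) (prodV-nonneg m (f ∘ suc) (0≤f ∘ suc))

  record IsSummation {A : Set} (S : (A → Carrier) → Carrier) : Set where
    field
      ∑-cong : ∀ {f g} → (∀ a → f a ≡ g a) → S f ≡ S g
      ∑-+    : ∀ f g → S (λ a → f a + g a) ≡ S f + S g
      ∑-*    : ∀ k f → S (λ a → k * f a) ≡ k * S f
      ∑-mono : ∀ {f g} → (∀ a → f a ≤ g a) → S f ≤ S g

    ∑-zero : S (λ _ → 0#) ≡ 0#
    ∑-zero = trans (∑-cong (λ _ → sym (zeroˡ 0#))) (trans (∑-* 0# (λ _ → 0#)) (zeroˡ _))

    ∑-nonneg : ∀ {f} → (∀ a → 0# ≤ f a) → 0# ≤ S f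
    ∑-nonneg 0≤f = ≤-respects ∑-zero refl (∑-mono 0≤f)

  Commutes : {A : Set} → ((A → Carrier) → Carrier) → Set₁
  Commutes {A} S = ∀ {B : Set} {U : (B → Carrier) → Carrier} → IsSummation U →
                   ∀ (F : A → B → Carrier) → S (λ a → U (F a)) ≡ U (λ b → S (λ a → F a b))

  module Iterated {A : Set} {S : (A → Carrier) → Carrier} (isS : IsSummation S)
    (T : (m : ℕ) → ((Fin m → A) → Carrier) → Carrier)
    (T-zero : ∀ F → T zero F ≡ F (λ ()))
    (T-suc : ∀ m F → T (suc m) F ≡ S (λ a → T m (λ g → F (a ∷ᵛ g)))) where

    private module S = IsSummation isS

    isSummation : ∀ m → IsSummation (T m)
    isSummation zero = record
      { ∑-cong = λ f≗g → trans (T-zero _) (trans (f≗g _) (sym (T-zero _)))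
      ; ∑-+    = λ f g → trans (T-zero _) (cong₂ _+_ (sym (T-zero f)) (sym (T-zero g)))
      ; ∑-*    = λ k f → trans (T-zero _) (cong (k *_) (sym (T-zero f)))
      ; ∑-mono = λ f≤g → ≤-respects (sym (T-zero _)) (sym (T-zero _)) (f≤g _)
      }
    isSummation (suc m) = record
      { ∑-cong = λ f≗g → trans (step (S.∑-cong λ a → T.∑-cong λ xs → f≗g (a ∷ᵛ xs))) (sym (T-suc m _))
      ; ∑-+    = λ f g → step (trans (S.∑-cong λ a → T.∑-+ (λ xs → f (a ∷ᵛ xs)) (λ xs → g (a ∷ᵛ xs)))
                                     (trans (S.∑-+ _ _) (cong₂ _+_ (sym (T-suc m f)) (sym (T-suc m g)))))
      ; ∑-*    = λ k f → step (trans (S.∑-cong λ a → T.∑-* k (λ g → f (a ∷ᵛ g)))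
                                     (trans (S.∑-* k _) (cong (k *_) (sym (T-suc m f)))))
      ; ∑-mono = λ f≤g → ≤-respects (sym (T-suc m _)) (sym (T-suc m _))
                                    (S.∑-mono λ a → T.∑-mono λ g → f≤g (a ∷ᵛ g))
      }
      where
      module T = IsSummation (isSummation m)
      step : ∀ {F x} → S (λ a → T m (λ g → F (a ∷ᵛ g))) ≡ x → T (suc m) F ≡ x
      step {F} = trans (T-suc m F)

    commutes : Commutes S → ∀ m → Commutes (T m)
    commutes S-commutes zero isU F =
      trans (T-zero _) (IsSummation.∑-cong isU λ b → sym (T-zero (λ x → F x b)))
    commutes S-commutes (suc m) {U = U′} isU F = begin
      T (suc m) (λ x → U′ (F x))                             ≡⟨ T-suc m _ ⟩
      S (λ a → T m (λ g → U′ (F (a ∷ᵛ g))))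
        ≡⟨ S.∑-cong (λ a → commutes S-commutes m isU (λ g → F (a ∷ᵛ g))) ⟩
      S (λ a → U′ (λ b → T m (λ g → F (a ∷ᵛ g) b)))          ≡⟨ S-commutes isU _ ⟩
      U′ (λ b → S (λ a → T m (λ g → F (a ∷ᵛ g) b)))
        ≡⟨ IsSummation.∑-cong isU (λ b → sym (T-suc m (λ x → F x b))) ⟩
      U′ (λ b → T (suc m) (λ x → F x b))                     ∎
      where
      open ≡-Reasoning

    expand : ∀ m (f : Fin m → A → Carrier) →
             prodV ℝ m (λ v → S (f v)) ≡ T m (λ g → prodV ℝ m (λ v → f v (g v)))
    expand zero    f = sym (T-zero _)
    expand (suc m) f = begin
      S (f zero) * prodV ℝ m (λ v → S (f (suc v)))
        ≡⟨ cong (S (f zero) *_) (expand m (λ v → f (suc v))) ⟩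
      S (f zero) * T m (λ g → rest g)
        ≡⟨ trans (*-comm _ _) (sym (S.∑-* _ (f zero))) ⟩
      S (λ a → T m (λ g → rest g) * f zero a)
        ≡⟨ S.∑-cong (λ a → trans (*-comm _ _) (sym (IsSummation.∑-* (isSummation m) (f zero a) rest))) ⟩
      S (λ a → T m (λ g → f zero a * rest g))
        ≡⟨ sym (T-suc m _) ⟩
      T (suc m) (λ g → prodV ℝ (suc m) (λ v → f v (g v)))  ∎
      where
      open ≡-Reasoning
      rest : (Fin m → A) → Carrier
      rest g = prodV ℝ m (λ v → f (suc v) (g v))

  Σ𝔹 : (Bool → Carrier) → Carrier
  Σ𝔹 f = f false + f true

  Σ𝔹-isSummation : IsSummation Σ𝔹
  Σ𝔹-isSummation = record
    { ∑-cong = λ f≗g → cong₂ _+_ (f≗g false) (f≗g true)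
    ; ∑-+    = λ f g → solve 4 (λ a b c d → ((a ⊕ b) ⊕ (c ⊕ d)) ⊜ ((a ⊕ c) ⊕ (b ⊕ d))) refl
                                (f false) (g false) (f true) (g true)
    ; ∑-*    = λ k f → sym (distribˡ k (f false) (f true))
    ; ∑-mono = λ f≤g → +-mono (f≤g false) (f≤g true)
    }

  Σ𝔹-commutes : Commutes Σ𝔹
  Σ𝔹-commutes isU F = sym (IsSummation.∑-+ isU (F false) (F true))

  module Bits = Iterated Σ𝔹-isSummation (sumBits ℝ) (λ _ → refl) (λ _ _ → refl)
  module Assignments = Iterated (Bits.isSummation 4) (sumAssign ℝ) (λ _ → refl) (λ _ _ → refl)

  sumAssign-isSummation : ∀ n → IsSummation (sumAssign ℝ n)
  sumAssign-isSummation = Assignments.isSummation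

  sumAssign-commutes : ∀ n → Commutes (sumAssign ℝ n)
  sumAssign-commutes = Assignments.commutes (Bits.commutes Σ𝔹-commutes 4)

  open SemiringSum (CommutativeRing.semiring commutativeRing) using ()
    renaming (sum to ∑ᴿ; sum-cong-≗ to ∑ᴿ-cong; ∑-distrib-+ to ∑ᴿ-distrib-+; *-distribˡ-sum to *-distribˡ-∑ᴿ)

  Fin-sum-isSummation : ∀ m → IsSummation (∑ᴿ {m})
  Fin-sum-isSummation m = record
    { ∑-cong = ∑ᴿ-cong
    ; ∑-+    = ∑ᴿ-distrib-+
    ; ∑-*    = λ k f → sym (*-distribˡ-∑ᴿ k f)
    ; ∑-mono = mono m
    }
    where
    mono : ∀ m {f g : Fin m → Carrier} → (∀ i → f i ≤ g i) → ∑ᴿ f ≤ ∑ᴿ g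
    mono zero    f≤g = ≤-refl
    mono (suc m) f≤g = +-mono (f≤g zero) (mono m (f≤g ∘ suc))

  ΣPairing : (Pairing → Carrier) → Carrier
  ΣPairing = ∑ᴿ

  sumChoices : (m : ℕ) → ((Fin m → Pairing) → Carrier) → Carrier
  sumChoices zero    F = F (λ ())
  sumChoices (suc m) F = ΣPairing (λ a → sumChoices m (λ g → F (a ∷ᵛ g)))

  module Choices = Iterated (Fin-sum-isSummation 6) sumChoices (λ _ → refl) (λ _ _ → refl)

  -- Reindexing a sum by updateAt is only pointwise, hence the extensionality hypotheses.
  Extensional : ∀ {k} → ((Fin k → Bool) → Carrier) → Set
  Extensional F = ∀ {x y} → (∀ i → x i ≡ y i) → F x ≡ F y

  sumBits-flip : ∀ k (j : Fin k) F → Extensional F → sumBits ℝ k (λ x → F (updateAt x j not)) ≡ sumBits ℝ k F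
  sumBits-flip (suc k) zero    F ext = trans (cong₂ _+_ (∑-cong (λ x → ext (λ { zero → refl ; (suc i) → refl })))
                                                      (∑-cong (λ x → ext (λ { zero → refl ; (suc i) → refl }))))
                                             (+-comm _ _)
    where open IsSummation (Bits.isSummation k)
  sumBits-flip (suc k) (suc j) F ext = cong₂ _+_ (flipTail false) (flipTail true)
    where
    open IsSummation (Bits.isSummation k)
    flipTail : ∀ b → sumBits ℝ k (λ x → F (updateAt (b ∷ᵛ x) (suc j) not)) ≡ sumBits ℝ k (λ x → F (b ∷ᵛ x))
    flipTail b = trans (∑-cong λ x → ext (λ { zero → refl ; (suc i) → refl }))
                       (sumBits-flip k j (λ x → F (b ∷ᵛ x)) (λ x≗y → ext (λ { zero → refl ; (suc i) → x≗y i })))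

  ExtensionalA : ∀ {n} → (Assignment n → Carrier) → Set
  ExtensionalA F = ∀ {σ τ} → (∀ v k → σ v k ≡ τ v k) → F σ ≡ F τ

  sumAssign-flip : ∀ n (x : HalfEdge n) F → ExtensionalA F → sumAssign ℝ n (λ σ → F (flipAt x σ)) ≡ sumAssign ℝ n F
  sumAssign-flip (suc n) (zero , k) F ext =
    trans (B.∑-cong {f = λ r → sumAssign ℝ n (λ σ → F (flipAt (zero , k) (r ∷ᵛ σ)))}
                    {g = λ r → sumAssign ℝ n (λ σ → F (updateAt r k not ∷ᵛ σ))}
                    λ r → A.∑-cong λ σ → ext λ { zero k′ → refl ; (suc v) k′ → refl })
          (sumBits-flip 4 k (λ r → sumAssign ℝ n (λ σ → F (r ∷ᵛ σ)))
                        (λ r≗r′ → A.∑-cong λ σ → ext λ { zero k′ → r≗r′ k′ ; (suc v) k′ → refl }))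
    where module B = IsSummation (Bits.isSummation 4)
          module A = IsSummation (sumAssign-isSummation n)
  sumAssign-flip (suc n) (suc v , k) F ext =
    B.∑-cong {f = λ r → sumAssign ℝ n (λ σ → F (flipAt (suc v , k) (r ∷ᵛ σ)))}
             {g = λ r → sumAssign ℝ n (λ σ → F (r ∷ᵛ σ))}
      λ r → trans (A.∑-cong {f = λ σ → F (flipAt (suc v , k) (r ∷ᵛ σ))} {g = λ σ → F (r ∷ᵛ flipAt (v , k) σ)}
                            λ σ → ext λ { zero k′ → refl ; (suc w) k′ → refl })
                  (sumAssign-flip n (v , k) (λ σ → F (r ∷ᵛ σ))
                                  (λ σ≗τ → ext λ { zero k′ → refl ; (suc w) k′ → σ≗τ w k′ }))
    where module B = IsSummation (Bits.isSummation 4)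
          module A = IsSummation (sumAssign-isSummation n)

  solutionCount : ∀ {n} → List (Eqn (End n)) → (Fin 4 → Bool) → Carrier
  solutionCount {n} E β = sumAssign ℝ n (λ σ → ⟦ solves (value σ β) E ⟧)

  solutionCount-≋ : ∀ {n} {E F : List (Eqn (End n))} β → E ≋ F → solutionCount E β ≡ solutionCount F β
  solutionCount-≋ {n} β E≋F = IsSummation.∑-cong (sumAssign-isSummation n) λ σ → cong ⟦_⟧ (same-solutions E≋F (value σ β))

  private
    self-loop : ∀ u c → not (u xor u xor c) ≡ not c
    self-loop false c = refl
    self-loop true  c = cong not (𝔹.not-involutive c)

  solutionCount-contradictory : ∀ {n} (x : HalfEdge n) R β → solutionCount ((inj₁ x , inj₁ x , true) ∷ R) β ≡ 0#
  solutionCount-contradictory {n} x R β =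
    trans (∑-cong λ σ → cong (λ b → ⟦ b ∧ solves (value σ β) R ⟧) (self-loop (value σ β (inj₁ x)) true)) ∑-zero
    where open IsSummation (sumAssign-isSummation n)

  solutionCount-loop : ∀ {n} (x : HalfEdge n) R β → solutionCount ((inj₁ x , inj₁ x , false) ∷ R) β ≡ solutionCount R β
  solutionCount-loop {n} x R β =
    ∑-cong λ σ → cong (λ b → ⟦ b ∧ solves (value σ β) R ⟧) (self-loop (value σ β (inj₁ x)) false)
    where open IsSummation (sumAssign-isSummation n)

  -- Flipping x is a bijection of assignments, and exactly one of σ and its flip satisfies both
  -- equations through x, precisely when o and o′ satisfy their sum.
  solutionCount-path : ∀ {n} (x : HalfEdge n) o o′ c d R β → o ≢ inj₁ x → o′ ≢ inj₁ x →
    occurrences (inj₁ x) R ≡ 0 →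
    solutionCount ((inj₁ x , o , c) ∷ (inj₁ x , o′ , d) ∷ R) β ≡ half * solutionCount ((o , o′ , c xor d) ∷ R) β
  solutionCount-path {n} x@(v , k) o o′ c d R β o≢x o′≢x x∉R =
    trans (sym (half-double _)) (cong (half *_) doubled)
    where
    open IsSummation (sumAssign-isSummation n)
    F : Assignment n → Carrier
    F σ = ⟦ solves (value σ β) ((inj₁ x , o , c) ∷ (inj₁ x , o′ , d) ∷ R) ⟧
    shape-cong : ∀ {u u′ a a′ b b′ r r′} → u ≡ u′ → a ≡ a′ → b ≡ b′ → r ≡ r′ →
                 ⟦ pathHolds u a b c d r ⟧ ≡ ⟦ pathHolds u′ a′ b′ c d r′ ⟧
    shape-cong refl refl refl refl = refl
    pair : ∀ σ → F σ + F (flipAt x σ) ≡ ⟦ solves (value σ β) ((o , o′ , c xor d) ∷ R) ⟧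
    pair σ = let u = σ v k ; a = value σ β o ; b = value σ β o′ ; r = solves (value σ β) R in
      trans (cong (F σ +_) (shape-cong (flipAt-self v k σ) (value-flipAt-other x σ β o o≢x)
                                       (value-flipAt-other x σ β o′ o′≢x) (solves-flipAt-unaffected x σ β R x∉R)))
            (trans (⟦∨⟧-disjoint (pathHolds u a b c d r) (pathHolds (not u) a b c d r) (proj₁ (merge-path u a b c d r)))
                   (cong ⟦_⟧ (proj₂ (merge-path u a b c d r))))
    doubled : sumAssign ℝ n F + sumAssign ℝ n F ≡ solutionCount ((o , o′ , c xor d) ∷ R) β
    doubled = trans (cong (sumAssign ℝ n F +_) (sym (sumAssign-flip n x F F-ext)))
                    (trans (sym (∑-+ F (F ∘ flipAt x))) (∑-cong pair))
      where
      F-ext : ExtensionalA F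
      F-ext σ≗τ = cong ⟦_⟧ (solves-cong (value-cong β σ≗τ) ((inj₁ x , o , c) ∷ (inj₁ x , o′ , d) ∷ R))

  record ScaledPairing (F : (Fin 4 → Bool) → Carrier) : Set where
    field
      scale        : Carrier
      scale-nonneg : 0# ≤ scale
      pairing      : Pairing
      evaluation   : ∀ β → F β ≡ scale * eightVertex ℝ (pairingParams pairing) β

  open ScaledPairing public

  ScaledPairing-≗ : ∀ {F G} → (∀ β → G β ≡ F β) → ScaledPairing F → ScaledPairing G
  ScaledPairing-≗ G≗F S = record
    { scale = scale S ; scale-nonneg = scale-nonneg S ; pairing = pairing S
    ; evaluation = λ β → trans (G≗F β) (evaluation S β) }

  solutionCount-scaledPairing : ∀ {n} (vs : List (HalfEdge n)) E → Invariant vs E → ScaledPairing (solutionCount E)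
  solutionCount-scaledPairing {n} [] E inv with pairing-of-external-system inv
  ... | g , agree = record
    { scale = sumAssign ℝ n (λ _ → 1#) ; scale-nonneg = ∑-nonneg (λ _ → 0≤1) ; pairing = g ; evaluation = λ β → begin
      solutionCount E β                                       ≡⟨ ∑-cong (λ σ → cong ⟦_⟧ (agree (value σ β))) ⟩
      sumAssign ℝ n (λ _ → ⟦ solves β (pairingEqns g) ⟧)      ≡⟨ ∑-cong (λ _ → sym (*-identityʳ _)) ⟩
      sumAssign ℝ n (λ _ → ⟦ solves β (pairingEqns g) ⟧ * 1#) ≡⟨ ∑-* _ (λ _ → 1#) ⟩
      ⟦ solves β (pairingEqns g) ⟧ * sumAssign ℝ n (λ _ → 1#) ≡⟨ *-comm _ _ ⟩
      sumAssign ℝ n (λ _ → 1#) * ⟦ solves β (pairingEqns g) ⟧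
        ≡⟨ cong (sumAssign ℝ n (λ _ → 1#) *_) (eightVertex-pairing g β) ⟨
      sumAssign ℝ n (λ _ → 1#) * eightVertex ℝ (pairingParams g) β ∎ }
    where
    open ≡-Reasoning
    open IsSummation (sumAssign-isSummation n)
  solutionCount-scaledPairing (x ∷ vs) E inv with eliminate inv
  ... | contradictory R E≋ = record
    { scale = 0# ; scale-nonneg = ≤-refl ; pairing = 0F
    ; evaluation = λ β → trans (solutionCount-≋ β E≋) (trans (solutionCount-contradictory x R β) (sym (zeroˡ _))) }
  ... | loop R E≋ inv′ = ScaledPairing-≗ (λ β → trans (solutionCount-≋ β E≋) (solutionCount-loop x R β))
                                          (solutionCount-scaledPairing vs R inv′)
  ... | path o o′ c d R o≢x o′≢x x∉R E≋ inv′ = let S = solutionCount-scaledPairing vs ((o , o′ , c xor d) ∷ R) inv′ in record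
    { scale = half * scale S ; scale-nonneg = *-nonneg half-nonneg (scale-nonneg S) ; pairing = pairing S
    ; evaluation = λ β → trans (solutionCount-≋ β E≋) (trans (solutionCount-path x o o′ c d R β o≢x o′≢x x∉R)
                           (trans (cong (half *_) (evaluation S β)) (sym (*-assoc half (scale S) _)))) }

  module _ {n} (Γ : Construction n) where
    open Construction Γ
    open ConstructionSystem Γ

    private
      differ : ∀ a b → not (a xor b xor true) ≡ a xor b
      differ false false = refl
      differ false true  = refl
      differ true  false = refl
      differ true  true  = refl

    okAt-edgeEqn : ∀ σ β h → okAt ℝ Γ σ β h ≡ holds (value σ β) (edgeEqn h)
    okAt-edgeEqn σ β (v , k) with match (inj₁ (v , k))
    ... | inj₁ (v′ , k′) = sym (differ (σ v k) (σ v′ k′))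
    ... | inj₂ i         = cong (λ b → not (σ v k xor b)) (sym (𝔹.xor-identityʳ (β i)))

    T-consistent : ∀ σ β → T (consistent ℝ Γ σ β) → ∀ h → T (okAt ℝ Γ σ β h)
    T-consistent σ β c (v , k) =
      tabulate⁻ {f = λ k → k} (all⁺ (λ k → okAt ℝ Γ σ β (v , k)) (allFin 4)
        (tabulate⁻ {f = λ v → v} (all⁺ (λ v → all (λ k → okAt ℝ Γ σ β (v , k)) (allFin 4)) (allFin n) c) v)) k

    consistent-intro : ∀ σ β → (∀ h → T (okAt ℝ Γ σ β h)) → T (consistent ℝ Γ σ β)
    consistent-intro σ β ok =
      all⁻ (λ v → all (λ k → okAt ℝ Γ σ β (v , k)) (allFin 4))
        (tabulate⁺ {f = λ v → v} λ v → all⁻ (λ k → okAt ℝ Γ σ β (v , k)) (tabulate⁺ {f = λ k → k} λ k → ok (v , k)))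

    private
      T-ext : ∀ {a b} → (T a → T b) → (T b → T a) → a ≡ b
      T-ext {false} {false} _ _ = refl
      T-ext {false} {true}  _ b→a = ⊥-elim (b→a tt)
      T-ext {true}  {false} a→b _ = ⊥-elim (a→b tt)
      T-ext {true}  {true}  _ _ = refl

      chosen : ∀ {P : Eqn (End n) → Set} {b x} → b ≡ true → All P (if b then x ∷ [] else []) → P x
      chosen refl (px ∷ []) = px

      indicator-true : ∀ {b} → [ b ] ≡ 1 → b ≡ true
      indicator-true {true} _ = refl

    ChosenEdge : (Assignment n) → (Fin 4 → Bool) → HalfEdge n → End n → Set
    ChosenEdge σ β h e = All (T ∘ holds (value σ β)) (if precedes h e then (inj₁ h , e , not (isExternal e)) ∷ [] else [])

    edges-hold : ∀ σ β → T (consistent ℝ Γ σ β) → T (solves (value σ β) (danglingEqns ++ internalEqns))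
    edges-hold σ β c = all⁻ (holds (value σ β)) (++⁺ danglingHold internalHold)
      where
      ok = T-consistent σ β c
      edge : ∀ h → T (holds (value σ β) (edgeEqn h))
      edge h = subst T (okAt-edgeEqn σ β h) (ok h)
      kept : ∀ h → ChosenEdge σ β h (match (inj₁ h))
      kept h with represents h
      ... | true  = edge h ∷ []
      ... | false = []
      danglingHold : All (T ∘ holds (value σ β)) danglingEqns
      danglingHold = concat⁺ (tabulate⁺ {f = λ i → edgeEqn (attach i) ∷ []} λ i → edge (attach i) ∷ [])
      internalHold : All (T ∘ holds (value σ β)) internalEqns
      internalHold = concat⁺ (tabulate⁺ {f = λ v → concat (tabulate λ k → if represents (v , k) then edgeEqn (v , k) ∷ [] else [])}
                   λ v → concat⁺ (tabulate⁺ {f = λ k → if represents (v , k) then edgeEqn (v , k) ∷ [] else []} λ k → kept (v , k)))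

    edges-consistent : ∀ σ β → T (solves (value σ β) (danglingEqns ++ internalEqns)) → T (consistent ℝ Γ σ β)
    edges-consistent σ β s = consistent-intro σ β λ h → subst T (sym (okAt-edgeEqn σ β h)) (edge h (match (inj₁ h)) refl)
      where
      ν = value σ β
      split = ++⁻ danglingEqns (all⁺ (holds ν) (danglingEqns ++ internalEqns) s)
      danglingHold : ∀ i → T (holds ν (edgeEqn (attach i)))
      danglingHold i with tabulate⁻ {f = λ i → edgeEqn (attach i) ∷ []} (concat⁻ (proj₁ split)) i
      ... | px ∷ [] = px
      kept : ∀ h → ChosenEdge σ β h (match (inj₁ h))
      kept (v , k) = tabulate⁻ {f = λ k → if represents (v , k) then edgeEqn (v , k) ∷ [] else []}
        (concat⁻ (tabulate⁻ {f = λ v → concat (tabulate λ k → if represents (v , k) then edgeEqn (v , k) ∷ [] else [])}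
                   (concat⁻ (proj₂ split)) v)) k
      edge : ∀ h e → match (inj₁ h) ≡ e → T (holds ν (inj₁ h , e , not (isExternal e)))
      edge h (inj₂ i) eq with refl ← trans (sym (trans (cong match (sym eq)) (involutive (inj₁ h)))) (proj₂ (dangling i)) =
        subst (λ e → T (holds ν (inj₁ (attach i) , e , not (isExternal e)))) (match-attach i) (danglingHold i)
      edge h (inj₁ h′) eq with h <ᴴ h′ in h<h′
      ... | true  = chosen h<h′ (subst (ChosenEdge σ β h) eq (kept h))
      ... | false = subst T (holds-swap ν (inj₁ h) (inj₁ h′) true)
                      (chosen h′<h (subst (ChosenEdge σ β h′) partner (kept h′)))
        where
        partner : match (inj₁ h′) ≡ inj₁ h
        partner = trans (cong match (sym eq)) (involutive (inj₁ h))
        h′<h : h′ <ᴴ h ≡ true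
        h′<h = indicator-true (trans (sym (cong (_+ℕ [ h′ <ᴴ h ]) (cong [_] h<h′)))
                                     (<ᴴ-exactly-one {h = h} {h′ = h′} λ { refl → noFix (inj₁ h) eq }))

    consistent≡solves : ∀ σ β → consistent ℝ Γ σ β ≡ solves (value σ β) (danglingEqns ++ internalEqns)
    consistent≡solves σ β = T-ext (edges-hold σ β) (edges-consistent σ β)

    private
      prodV-solves : ∀ {m} ν (f : Fin m → List (Eqn (End n))) →
                     prodV ℝ m (λ v → ⟦ solves ν (f v) ⟧) ≡ ⟦ solves ν (concat (tabulate f)) ⟧
      prodV-solves {zero}  ν f = refl
      prodV-solves {suc m} ν f = trans (cong (⟦ solves ν (f zero) ⟧ *_) (prodV-solves ν (f ∘ suc)))
        (trans (sym (⟦∧⟧ (solves ν (f zero)) _)) (cong ⟦_⟧ (sym (solves-++ ν (f zero) _))))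

      if-⟦⟧ : ∀ c a → (if c then ⟦ a ⟧ else 0#) ≡ ⟦ a ∧ c ⟧
      if-⟦⟧ true  a = cong ⟦_⟧ (sym (𝔹.∧-identityʳ a))
      if-⟦⟧ false a = cong ⟦_⟧ (sym (𝔹.∧-zeroʳ a))

    constructionFn≡solutionCount : ∀ g β → constructionFn ℝ Γ (pairingParams ∘ g) β ≡ solutionCount (system g) β
    constructionFn≡solutionCount g β = IsSummation.∑-cong (sumAssign-isSummation n) λ σ → let ν = value σ β in begin
      (if consistent ℝ Γ σ β then prodV ℝ n (λ v → eightVertex ℝ (pairingParams (g v)) (σ v)) else 0#)
        ≡⟨ cong₂ (λ c P → if c then P else 0#) (consistent≡solves σ β) (vertices σ) ⟩
      (if solves ν (danglingEqns ++ internalEqns) then ⟦ solves ν (vertexEqns g) ⟧ else 0#)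
        ≡⟨ if-⟦⟧ (solves ν (danglingEqns ++ internalEqns)) (solves ν (vertexEqns g)) ⟩
      ⟦ solves ν (vertexEqns g) ∧ solves ν (danglingEqns ++ internalEqns) ⟧
        ≡⟨ cong ⟦_⟧ (sym (solves-++ ν (vertexEqns g) _)) ⟩
      ⟦ solves ν (system g) ⟧ ∎
      where
      open ≡-Reasoning
      vertices : ∀ σ → prodV ℝ n (λ v → eightVertex ℝ (pairingParams (g v)) (σ v)) ≡ ⟦ solves (value σ β) (vertexEqns g) ⟧
      vertices σ = trans (prodV-cong λ v → trans (eightVertex-pairing (g v) (σ v))
                                                  (cong ⟦_⟧ (sym (solves-map (at v) (value σ β) (pairingEqns (g v))))))
                         (prodV-solves (value σ β) λ v → map (mapEqn (at v)) (pairingEqns (g v)))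

    pairing-construction : ∀ g → ScaledPairing (constructionFn ℝ Γ (pairingParams ∘ g))
    pairing-construction g = ScaledPairing-≗ (constructionFn≡solutionCount g)
                               (solutionCount-scaledPairing halfEdges (system g) (initial-invariant g))

  -- The cone F̄

  combination : ∀ {X : Set} → ((X → Carrier) → Carrier) → (X → Carrier) → (X → Params ℝ) → Params ℝ
  combination S w f =
    S (λ y → w y * a (f y)) , S (λ y → w y * b (f y)) , S (λ y → w y * c (f y)) , S (λ y → w y * d (f y))
    where
    a b c d : Params ℝ → Carrier
    a (x , _ , _ , _) = x
    b (_ , x , _ , _) = x
    c (_ , _ , x , _) = x
    d (_ , _ , _ , x) = x

  module _ {X : Set} {S : (X → Carrier) → Carrier} (isS : IsSummation S) (w : X → Carrier) (f : X → Params ℝ) where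
    open IsSummation isS

    private
      vanish : 0# ≡ S (λ y → w y * 0#)
      vanish = sym (trans (∑-cong λ y → zeroʳ (w y)) ∑-zero)

    evalEV-combination : ∀ b₀ b₁ b₂ b₃ →
                         evalEV ℝ (combination S w f) b₀ b₁ b₂ b₃ ≡ S (λ y → w y * evalEV ℝ (f y) b₀ b₁ b₂ b₃)
    evalEV-combination false false false false = refl
    evalEV-combination false false false true  = vanish
    evalEV-combination false false true  false = vanish
    evalEV-combination false false true  true  = refl
    evalEV-combination false true  false false = vanish
    evalEV-combination false true  false true  = refl
    evalEV-combination false true  true  false = refl
    evalEV-combination false true  true  true  = vanish
    evalEV-combination true  false false false = vanish
    evalEV-combination true  false false true  = refl
    evalEV-combination true  false true  false = refl
    evalEV-combination true  false true  true  = vanish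
    evalEV-combination true  true  false false = refl
    evalEV-combination true  true  false true  = vanish
    evalEV-combination true  true  true  false = vanish
    evalEV-combination true  true  true  true  = refl

    eightVertex-combination : ∀ x → eightVertex ℝ (combination S w f) x ≡ S (λ y → w y * eightVertex ℝ (f y) x)
    eightVertex-combination x = evalEV-combination (x 0F) (x 1F) (x 2F) (x 3F)

    InFbar-combination : (∀ y → 0# ≤ w y) → (∀ y → InFbar ℝ (f y)) → InFbar ℝ (combination S w f)
    InFbar-combination 0≤w F =
      nonneg (λ { (p , _) → p }) , nonneg (λ { (_ , p , _) → p }) ,
      nonneg (λ { (_ , _ , p , _) → p }) , nonneg (λ { (_ , _ , _ , p , _) → p }) ,
      bound (λ { (_ , _ , _ , _ , p , _) → p }) , bound (λ { (_ , _ , _ , _ , _ , p , _) → p }) ,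
      bound (λ { (_ , _ , _ , _ , _ , _ , p , _) → p }) , bound (λ { (_ , _ , _ , _ , _ , _ , _ , p) → p })
      where
      nonneg : ∀ {p : X → Carrier} → (∀ {y} → InFbar ℝ (f y) → 0# ≤ p y) → 0# ≤ S (λ y → w y * p y)
      nonneg get = ∑-nonneg λ y → *-nonneg (0≤w y) (get (F y))
      bound : ∀ {p q r s : X → Carrier} → (∀ {y} → InFbar ℝ (f y) → p y ≤ q y + r y + s y) →
              S (λ y → w y * p y) ≤ S (λ y → w y * q y) + S (λ y → w y * r y) + S (λ y → w y * s y)
      bound {p} {q} {r} {s} get = ≤-respects refl
        (trans (∑-cong λ y → solve 4 (λ k x y z → (k ⊗ ((x ⊕ y) ⊕ z)) ⊜ (((k ⊗ x) ⊕ (k ⊗ y)) ⊕ (k ⊗ z))) refl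
                                     (w y) (q y) (r y) (s y))
               (trans (∑-+ _ _) (cong (_+ S (λ y → w y * s y)) (∑-+ _ _))))
        (∑-mono λ y → *-monoˡ (0≤w y) (get (F y)))

  record K₄Weighting (a b c d : Carrier) : Set where
    field
      ab cd ac bd ad bc : Carrier
      nonneg   : 0# ≤ ab × 0# ≤ cd × 0# ≤ ac × 0# ≤ bd × 0# ≤ ad × 0# ≤ bc
      degree-a : ab + ac + ad ≡ a
      degree-b : ab + bd + bc ≡ b
      degree-c : cd + ac + bc ≡ c
      degree-d : cd + bd + ad ≡ d

  private
    swap-last : ∀ x y z → x + y + z ≡ x + z + y
    swap-last = solve 3 (λ x y z → ((x ⊕ y) ⊕ z) ⊜ ((x ⊕ z) ⊕ y)) refl

  swap-ab : ∀ {a b c d} → K₄Weighting a b c d → K₄Weighting b a c d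
  swap-ab W = record
    { ab = ab ; cd = cd ; ac = bc ; bd = ad ; ad = bd ; bc = ac
    ; nonneg   = let (p₁ , p₂ , p₃ , p₄ , p₅ , p₆) = nonneg in p₁ , p₂ , p₆ , p₅ , p₄ , p₃
    ; degree-a = trans (swap-last ab bc bd) degree-b
    ; degree-b = trans (swap-last ab ad ac) degree-a
    ; degree-c = trans (swap-last cd bc ac) degree-c
    ; degree-d = trans (swap-last cd ad bd) degree-d
    }
    where open K₄Weighting W

  swap-cd : ∀ {a b c d} → K₄Weighting a b c d → K₄Weighting a b d c
  swap-cd W = record
    { ab = ab ; cd = cd ; ac = ad ; bd = bc ; ad = ac ; bc = bd
    ; nonneg   = let (p₁ , p₂ , p₃ , p₄ , p₅ , p₆) = nonneg in p₁ , p₂ , p₅ , p₆ , p₃ , p₄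
    ; degree-a = trans (swap-last ab ad ac) degree-a
    ; degree-b = trans (swap-last ab bc bd) degree-b
    ; degree-c = trans (swap-last cd ad bd) degree-d
    ; degree-d = trans (swap-last cd bc ac) degree-c
    }
    where open K₄Weighting W

  swap-pairs : ∀ {a b c d} → K₄Weighting a b c d → K₄Weighting c d a b
  swap-pairs W = record
    { ab = cd ; cd = ab ; ac = ac ; bd = bd ; ad = bc ; bc = ad
    ; nonneg   = let (p₁ , p₂ , p₃ , p₄ , p₅ , p₆) = nonneg in p₂ , p₁ , p₃ , p₄ , p₆ , p₅
    ; degree-a = degree-c
    ; degree-b = degree-d
    ; degree-c = degree-a
    ; degree-d = degree-b
    }
    where open K₄Weighting W

  halve : ∀ {a b c d} → K₄Weighting (a + a) (b + b) (c + c) (d + d) → K₄Weighting a b c d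
  halve {a} {b} {c} {d} W = record
    { ab = half * ab ; cd = half * cd ; ac = half * ac ; bd = half * bd ; ad = half * ad ; bc = half * bc
    ; nonneg   = let (p₁ , p₂ , p₃ , p₄ , p₅ , p₆) = nonneg in
                 *-nonneg half-nonneg p₁ , *-nonneg half-nonneg p₂ , *-nonneg half-nonneg p₃ ,
                 *-nonneg half-nonneg p₄ , *-nonneg half-nonneg p₅ , *-nonneg half-nonneg p₆
    ; degree-a = scaled degree-a
    ; degree-b = scaled degree-b
    ; degree-c = scaled degree-c
    ; degree-d = scaled degree-d
    }
    where
    open K₄Weighting W
    scaled : ∀ {x y z e} → x + y + z ≡ e + e → half * x + half * y + half * z ≡ e
    scaled {x} {y} {z} {e} sum≡ =
      trans (solve 4 (λ h x y z → (((h ⊗ x) ⊕ (h ⊗ y)) ⊕ (h ⊗ z)) ⊜ (h ⊗ ((x ⊕ y) ⊕ z))) refl half x y z)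
                                      (trans (cong (half *_) sum≡) (half-double e))

  slack : ∀ {x y} → x ≤ y → Σ Carrier λ s → 0# ≤ s × x + s ≡ y
  slack {x} {y} x≤y = y + - x , difference-nonneg x≤y , x+[y-x]≡y x y

  -- The case x - y ≥ |z - w|; decompose reduces to it by relabelling.
  dominant : ∀ {x y z w} → 0# ≤ y → y + w ≤ x + z → y + z ≤ x + w → x ≤ y + z + w →
             K₄Weighting (x + x) (y + y) (z + z) (w + w)
  dominant {x} {y} {z} {w} 0≤y h₁ h₂ h₃ with slack h₁ | slack h₂ | slack h₃
  ... | s₁ , 0≤s₁ , e₁ | s₂ , 0≤s₂ , e₂ | t , 0≤t , e₃ = record
    { ab = y + y ; cd = t ; ac = s₁ ; bd = 0# ; ad = s₂ ; bc = 0#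
    ; nonneg   = +-nonneg 0≤y 0≤y , 0≤t , 0≤s₁ , ≤-refl , 0≤s₂ , ≤-refl
    ; degree-a = +-cancelʳ (z + w) _ _ (begin
        y + y + s₁ + s₂ + (z + w)
          ≡⟨ solve 5 (λ y z w s₁ s₂ → ((((y ⊕ y) ⊕ s₁) ⊕ s₂) ⊕ (z ⊕ w)) ⊜ (((y ⊕ w) ⊕ s₁) ⊕ ((y ⊕ z) ⊕ s₂))) refl
                     y z w s₁ s₂ ⟩
        (y + w + s₁) + (y + z + s₂)      ≡⟨ cong₂ _+_ e₁ e₂ ⟩
        (x + z) + (x + w)                ≡⟨ solve 3 (λ x z w → ((x ⊕ z) ⊕ (x ⊕ w)) ⊜ ((x ⊕ x) ⊕ (z ⊕ w))) refl x z w ⟩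
        x + x + (z + w)                  ∎)
    ; degree-b = trans (+-identityʳ _) (+-identityʳ _)
    ; degree-c = trans (+-identityʳ _) (+-cancelʳ (x + (y + w)) _ _ (begin
        t + s₁ + (x + (y + w))
          ≡⟨ solve 5 (λ t s₁ x y w → ((t ⊕ s₁) ⊕ (x ⊕ (y ⊕ w))) ⊜ ((x ⊕ t) ⊕ ((y ⊕ w) ⊕ s₁))) refl t s₁ x y w ⟩
        (x + t) + (y + w + s₁)           ≡⟨ cong₂ _+_ e₃ e₁ ⟩
        (y + z + w) + (x + z)
          ≡⟨ solve 4 (λ x y z w → (((y ⊕ z) ⊕ w) ⊕ (x ⊕ z)) ⊜ ((z ⊕ z) ⊕ (x ⊕ (y ⊕ w)))) refl x y z w ⟩
        z + z + (x + (y + w))            ∎))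
    ; degree-d = trans (cong (_+ s₂) (+-identityʳ t)) (+-cancelʳ (x + (y + z)) _ _ (begin
        t + s₂ + (x + (y + z))
          ≡⟨ solve 5 (λ t s₂ x y z → ((t ⊕ s₂) ⊕ (x ⊕ (y ⊕ z))) ⊜ ((x ⊕ t) ⊕ ((y ⊕ z) ⊕ s₂))) refl t s₂ x y z ⟩
        (x + t) + (y + z + s₂)           ≡⟨ cong₂ _+_ e₃ e₂ ⟩
        (y + z + w) + (x + w)
          ≡⟨ solve 4 (λ x y z w → (((y ⊕ z) ⊕ w) ⊕ (x ⊕ w)) ⊜ ((w ⊕ w) ⊕ (x ⊕ (y ⊕ z)))) refl x y z w ⟩
        w + w + (x + (y + z))            ∎))
    }
    where open ≡-Reasoning

  private
    commuted : ∀ {p q r s} → p + q ≤ r + s → q + p ≤ s + r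
    commuted {p} {q} {r} {s} = ≤-respects (+-comm p q) (+-comm r s)

    rotate : ∀ x y z → x + y + z ≡ z + x + y
    rotate = solve 3 (λ x y z → ((x ⊕ y) ⊕ z) ⊜ ((z ⊕ x) ⊕ y)) refl

  decompose : ∀ {a b c d} → InFbar ℝ (a , b , c , d) → K₄Weighting a b c d
  decompose {a} {b} {c} {d} (0≤a , 0≤b , 0≤c , 0≤d , a≤ , b≤ , c≤ , d≤)
    with total (b + d) (a + c) | total (b + c) (a + d)
  ... | inj₁ bd≤ac | inj₁ bc≤ad = halve (dominant 0≤b bd≤ac bc≤ad a≤)
  ... | inj₁ bd≤ac | inj₂ ad≤bc = swap-pairs (halve (dominant 0≤d (commuted bd≤ac) (commuted ad≤bc)
                                    (≤-respects refl (rotate a b d) c≤)))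
  ... | inj₂ ac≤bd | inj₁ bc≤ad = swap-cd (swap-pairs (halve (dominant 0≤c (commuted bc≤ad) (commuted ac≤bd)
                                    (≤-respects refl (rotate a b c) d≤))))
  ... | inj₂ ac≤bd | inj₂ ad≤bc = swap-ab (halve (dominant 0≤a ad≤bc ac≤bd b≤))

  private
    pick : ∀ x b → x * ⟦ b ⟧ ≡ (if b then x else 0#)
    pick x true  = *-identityʳ x
    pick x false = zeroʳ x

  private
    tidy-a : ∀ p q r → p + (0# + (q + (0# + (r + (0# + 0#))))) ≡ p + q + r
    tidy-a p q r rewrite +-identityˡ 0# | +-identityʳ r | +-identityˡ r | +-identityˡ (q + r) = sym (+-assoc p q r)

    tidy-b : ∀ p q r → p + (0# + (0# + (q + (0# + (r + 0#))))) ≡ p + q + r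
    tidy-b p q r rewrite +-identityʳ r | +-identityˡ r | +-identityˡ (q + r) | +-identityˡ (q + r) = sym (+-assoc p q r)

    tidy-c : ∀ p q r → 0# + (p + (q + (0# + (0# + (r + 0#))))) ≡ p + q + r
    tidy-c p q r rewrite +-identityʳ r | +-identityˡ r | +-identityˡ r | +-identityˡ (p + (q + r)) = sym (+-assoc p q r)

    tidy-d : ∀ p q r → 0# + (p + (0# + (q + (r + (0# + 0#))))) ≡ p + q + r
    tidy-d p q r rewrite +-identityˡ 0# | +-identityʳ r | +-identityˡ (q + r) | +-identityˡ (p + (q + r)) = sym (+-assoc p q r)

  K₄Weighting⇒combination : ∀ {a b c d} → K₄Weighting a b c d →
    Σ (Pairing → Carrier) λ w → (∀ g → 0# ≤ w g) × (a , b , c , d) ≡ combination ΣPairing w pairingParams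
  K₄Weighting⇒combination {a} {b} {c} {d} W = w , w-nonneg ,
    cong₂ _,_ (sym (trans (selected proj₁) (trans (tidy-a ab ac ad) degree-a)))
   (cong₂ _,_ (sym (trans (selected (proj₁ ∘ proj₂)) (trans (tidy-b ab bd bc) degree-b)))
   (cong₂ _,_ (sym (trans (selected (proj₁ ∘ proj₂ ∘ proj₂)) (trans (tidy-c cd ac bc) degree-c)))
              (sym (trans (selected (proj₂ ∘ proj₂ ∘ proj₂)) (trans (tidy-d cd bd ad) degree-d)))))
    where
    open K₄Weighting W
    w : Pairing → Carrier
    w 0F = ab
    w 1F = cd
    w 2F = ac
    w 3F = bd
    w 4F = ad
    w 5F = bc
    w-nonneg : ∀ g → 0# ≤ w g
    w-nonneg 0F = proj₁ nonneg
    w-nonneg 1F = proj₁ (proj₂ nonneg)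
    w-nonneg 2F = proj₁ (proj₂ (proj₂ nonneg))
    w-nonneg 3F = proj₁ (proj₂ (proj₂ (proj₂ nonneg)))
    w-nonneg 4F = proj₁ (proj₂ (proj₂ (proj₂ (proj₂ nonneg))))
    w-nonneg 5F = proj₂ (proj₂ (proj₂ (proj₂ (proj₂ nonneg))))
    selected : (flag : Flags → Bool) →
               ΣPairing (λ g → w g * ⟦ flag (pairingFlags g) ⟧) ≡ ΣPairing (λ g → if flag (pairingFlags g) then w g else 0#)
    selected flag = IsSummation.∑-cong (Fin-sum-isSummation 6) {f = λ g → w g * ⟦ flag (pairingFlags g) ⟧}
                      {g = λ g → if flag (pairingFlags g) then w g else 0#} λ g → pick (w g) (flag (pairingFlags g))

  private
    indicator-bound : ∀ a b c d → T (not a ∨ b ∨ c ∨ d) → ⟦ a ⟧ ≤ ⟦ b ⟧ + ⟦ c ⟧ + ⟦ d ⟧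
    indicator-bound false b     c     d     _ = +-nonneg (+-nonneg (⟦⟧-nonneg b) (⟦⟧-nonneg c)) (⟦⟧-nonneg d)
    indicator-bound true  true  c     d     _ = ≤-trans (x≤x+y (⟦⟧-nonneg c)) (x≤x+y (⟦⟧-nonneg d))
    indicator-bound true  false true  d     _ = ≤-trans (≤-respects refl (sym (+-identityˡ 1#)) ≤-refl) (x≤x+y (⟦⟧-nonneg d))
    indicator-bound true  false false true  _ = ≤-respects refl (sym (trans (cong (_+ 1#) (+-identityˡ 0#)) (+-identityˡ 1#))) ≤-refl
    indicator-bound true  false false false ()

  pairing-InFbar : ∀ g → InFbar ℝ (pairingParams g)
  pairing-InFbar g = InFbar-flags (pairingFlags g) (valid g)
    where
    Valid : Flags → Set
    Valid (a , b , c , d) = T (not a ∨ b ∨ c ∨ d) × T (not b ∨ a ∨ c ∨ d) ×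
                            T (not c ∨ a ∨ b ∨ d) × T (not d ∨ a ∨ b ∨ c)
    InFbar-flags : ∀ fl → Valid fl → InFbar ℝ ⟦ fl ⟧ᴾ
    InFbar-flags (a , b , c , d) (va , vb , vc , vd) =
      ⟦⟧-nonneg a , ⟦⟧-nonneg b , ⟦⟧-nonneg c , ⟦⟧-nonneg d ,
      indicator-bound a b c d va , indicator-bound b a c d vb , indicator-bound c a b d vc , indicator-bound d a b c vd
    valid : ∀ g → Valid (pairingFlags g)
    valid 0F = _
    valid 1F = _
    valid 2F = _
    valid 3F = _
    valid 4F = _
    valid 5F = _

  record PairingExpansion (q : Params ℝ) : Set where
    field
      weight        : Pairing → Carrier
      weight-nonneg : ∀ g → 0# ≤ weight g
      expands       : ∀ x → eightVertex ℝ q x ≡ ΣPairing (λ g → weight g * eightVertex ℝ (pairingParams g) x)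

  open PairingExpansion public

  pairing-expansion : ∀ {q} → InFbar ℝ q → PairingExpansion q
  pairing-expansion {q} q∈F̄ with K₄Weighting⇒combination (decompose q∈F̄)
  ... | w , w-nonneg , q≡ = record
    { weight = w ; weight-nonneg = w-nonneg
    ; expands = λ x → trans (cong (λ q → eightVertex ℝ q x) q≡) (eightVertex-combination (Fin-sum-isSummation 6) w pairingParams x) }

  constructionFn-multilinear : ∀ {n} (Γ : Construction n) p (E : ∀ v → PairingExpansion (p v)) →
    ∀ β → constructionFn ℝ Γ p β ≡
          sumChoices n (λ h → prodV ℝ n (λ v → weight (E v) (h v)) * constructionFn ℝ Γ (pairingParams ∘ h) β)
  constructionFn-multilinear {n} Γ p E β = begin
    sumAssign ℝ n (λ σ → if consistent ℝ Γ σ β then prodV ℝ n (λ v → eightVertex ℝ (p v) (σ v)) else 0#)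
      ≡⟨ A.∑-cong pointwise ⟩
    sumAssign ℝ n (λ σ → sumChoices n (λ h → W h * I σ h))
      ≡⟨ sumAssign-commutes n (Choices.isSummation n) (λ σ h → W h * I σ h) ⟩
    sumChoices n (λ h → sumAssign ℝ n (λ σ → W h * I σ h))
      ≡⟨ C.∑-cong (λ h → A.∑-* (W h) (λ σ → I σ h)) ⟩
    sumChoices n (λ h → W h * constructionFn ℝ Γ (pairingParams ∘ h) β) ∎
    where
    open ≡-Reasoning
    module A = IsSummation (sumAssign-isSummation n)
    module C = IsSummation (Choices.isSummation n)
    W : (Fin n → Pairing) → Carrier
    W h = prodV ℝ n (λ v → weight (E v) (h v))
    I : Assignment n → (Fin n → Pairing) → Carrier
    I σ h = if consistent ℝ Γ σ β then prodV ℝ n (λ v → eightVertex ℝ (pairingParams (h v)) (σ v)) else 0#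
    pointwise : ∀ σ → (if consistent ℝ Γ σ β then prodV ℝ n (λ v → eightVertex ℝ (p v) (σ v)) else 0#) ≡
                      sumChoices n (λ h → W h * (if consistent ℝ Γ σ β
                                                  then prodV ℝ n (λ v → eightVertex ℝ (pairingParams (h v)) (σ v)) else 0#))
    pointwise σ with consistent ℝ Γ σ β
    ... | false = sym (trans (C.∑-cong (λ h → zeroʳ (W h))) C.∑-zero)
    ... | true  = trans (prodV-cong (λ v → expands (E v) (σ v)))
                 (trans (Choices.expand n (λ v g → weight (E v) g * eightVertex ℝ (pairingParams g) (σ v)))
                        (C.∑-cong (λ h → prodV-* n (λ v → weight (E v) (h v)) (λ v → eightVertex ℝ (pairingParams (h v)) (σ v)))))

mainTheorem1 : (ℝ : RealModel) → (n : ℕ) → (Γ : Construction n) →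
    (p : Fin n → Params ℝ) → (∀ v → InFbar ℝ (p v)) →
    ∃[ q ] (InFbar ℝ q × (∀ (β : Fin 4 → Bool) → constructionFn ℝ Γ p β ≡ eightVertex ℝ q β))
mainTheorem1 ℝ n Γ p p∈F̄ = q , InFbar-combination choices K f K-nonneg (pairing-InFbar ∘ P) , λ β → begin
    constructionFn ℝ Γ p β                                              ≡⟨ constructionFn-multilinear Γ p expansion β ⟩
    sumChoices n (λ h → W h * constructionFn ℝ Γ (pairingParams ∘ h) β) ≡⟨ ∑-cong (λ h → reduce h β) ⟩
    sumChoices n (λ h → K h * eightVertex ℝ (f h) β)                    ≡⟨ eightVertex-combination choices K f β ⟨
    eightVertex ℝ q β                                                   ∎
  where
  open Reals ℝ
  open ≡-Reasoning
  choices = Choices.isSummation n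
  open IsSummation choices using (∑-cong)
  expansion : ∀ v → PairingExpansion (p v)
  expansion v = pairing-expansion (p∈F̄ v)
  reduced : ∀ h → ScaledPairing (constructionFn ℝ Γ (pairingParams ∘ h))
  reduced = pairing-construction Γ
  W K : (Fin n → Pairing) → Carrier
  W h = prodV ℝ n (λ v → weight (expansion v) (h v))
  K h = W h * scale (reduced h)
  P : (Fin n → Pairing) → Pairing
  P h = pairing (reduced h)
  f : (Fin n → Pairing) → Params ℝ
  f = pairingParams ∘ P
  reduce : ∀ h β → W h * constructionFn ℝ Γ (pairingParams ∘ h) β ≡ K h * eightVertex ℝ (f h) β
  reduce h β = trans (cong (W h *_) (evaluation (reduced h) β)) (sym (*-assoc _ _ _))
  K-nonneg : ∀ h → 0# ≤ K h
  K-nonneg h = *-nonneg (prodV-nonneg n _ λ v → weight-nonneg (expansion v) (h v)) (scale-nonneg (reduced h))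
  q : Params ℝ
  q = combination (sumChoices n) K f
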